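{- For every set supercomposition $I=(I_1,\ldots,I_k)$, $$\Delta(M_I)=\sum_{i=0}^kM_{\operatorname{std}(I_1,\ldots,I_i)}\otimes M_{\operatorname{std}(I_{i+1},\ldots,I_k)}.$$
   Context: $\mathbb{Q}^\theta\langle\langle x\rangle\rangle$: bounded-degree formal power series over $\mathbb{Q}$ in noncommuting $x_1,x_2,\ldots$ and $\theta_1,\theta_2,\ldots$ with $x_i\theta_j=\theta_jx_i$, $\theta_i\theta_j=-\theta_j\theta_i$. A set supercomposition of bidegree $(n,m)$ is a sequence $(I_1,\ldots,I_k)$ of nonempty subsets of $\{0,\ldots,n\}$ with $I_i\cap I_j\subseteq\{0\}$ ($i\ne j$), $\bigcup(I_i\setminus\{0\})=[n]$, $m$ blocks containing $0$ (fermionic). For a monic monomial $u$, relabel its index set order-preservingly onto $[k]$ to get $\theta_{i_1}\cdots\theta_{i_m}x_{j_1}\cdots x_{j_n}$ ($i_1<\cdots<i_m$), and let $I(u)=(I_1,\ldots,I_k)$, $I_r=\{t: j_t=r\}\cup(\{0\}$ if $r\in\{i_1,\ldots,i_m\})$. $M_I=\sum_{I(u)=I}u$; $\operatorname{sNCQSym}$ is spanned by these. For a sequence of subsets of $\mathbb{N}_0$, $\operatorname{std}$ replaces its nonzero elements by $1,\ldots,n$ via the order-preserving bijection; $M_{()}=1$. $\Delta$: let $\mathbb{Q}^{\theta,\vartheta}\langle\langle x,y\rangle\rangle$ be the analogous algebra in noncommuting $x_i,y_j$ and anticommuting $\theta_i,\vartheta_j$ ($\theta$'s and $\vartheta$'s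 mutually anticommute and commute with all $x,y$). Order the alphabets as $x_1<x_2<\cdots<y_1<y_2<\cdots$ and $\theta_1<\theta_2<\cdots<\vartheta_1<\vartheta_2<\cdots$ (with $x_i$ paired with $\theta_i$ and $y_j$ with $\vartheta_j$), and let $M_I(x,y;\theta,\vartheta)$ be $M_I$ evaluated on these totally ordered alphabets. Its image modulo the relations $x_iy_j=y_jx_i$ is identified with an element of the super tensor product $\mathbb{Q}^\theta\langle\langle x\rangle\rangle\otimes\mathbb{Q}^\vartheta\langle\langle y\rangle\rangle$ (product $(f_1\otimes g_1)(f_2\otimes g_2)=(-1)^{|f_2||g_1|}f_1f_2\otimes g_1g_2$, parity = parity of the number of $\theta$'s); this element is $\Delta(M_I)$, and $\Delta$ is extended linearly. -}

module Defs where

open import Level using (Level)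
open import Data.Bool using (Bool; true; false; if_then_else_)
open import Data.Nat as ℕ using (ℕ; zero; suc; _≤_)
import Data.Nat.Properties as ℕₚ
open import Data.Sum using (_⊎_; inj₁; inj₂)
open import Data.Product using (_×_; _,_; ∃-syntax)
open import Data.List using (List; []; _∷_; _++_; map; length; foldr; concat; filter; take; drop; upTo; lookup)
open import Data.List.Properties using (≡-dec)
open import Data.List.Membership.Propositional using (_∈_)
open import Data.List.Relation.Unary.Linked using (Linked; linked?)
open import Data.List.Relation.Unary.All using (All)
open import Data.Fin using (Fin)
open import Data.Rational using (ℚ; 0ℚ; 1ℚ; _+_; _*_)
open import Relation.Binary using (StrictTotalOrder; tri<; tri≈; tri>)
open import Relation.Binary.PropositionalEquality using (_≡_; _≢_)
open import Relation.Nullary using (Dec; yes; no; ¬_)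
open import Relation.Nullary.Decidable using (⌊_⌋; _×-dec_; ¬?)
import Data.Sum.Relation.Binary.LeftOrder as LO

-- Set supercompositions.
-- A block (subset of {0,…,n}) is represented canonically by the
-- strictly increasing list of its elements; a set supercomposition
-- (I₁,…,I_k) is the list of its blocks.

Block : Set
Block = List ℕ

SetSeq : Set
SetSeq = List Block

-- (I₁,…,I_k) is a set supercomposition of {0,…,n}
-- (its fermionic degree m = number of blocks containing 0 is then determined).
record IsSetSupercomposition (n : ℕ) (I : SetSeq) : Set where
  field
    canonical : All (Linked ℕ._<_) I
    nonempty  : All (λ B → ¬ (B ≡ [])) I
    bounded   : All (All (_≤ n)) I
    disjoint  : (i j : Fin (length I)) → i ≢ j →
                (a : ℕ) → a ∈ lookup I i → a ∈ lookup I j → a ≡ 0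
    covering  : (a : ℕ) → 1 ≤ a → a ≤ n → ∃[ B ] (B ∈ I × a ∈ B)

std : SetSeq → SetSeq
std J = map (map rank) J
  where
  nonzero : List ℕ
  nonzero = filter (λ a → ¬? (a ℕ.≟ 0)) (concat J)
  rank : ℕ → ℕ
  rank zero = zero
  rank a@(suc _) = suc (length (filter (λ b → b ℕ.<? a) nonzero))

-- A (monic) monomial θ_{i₁}⋯θ_{i_m} x_{j₁}⋯x_{j_n} is given by the list
-- (i₁,…,i_m) of θ-indices and the word (j₁,…,j_n).  The monomial basis
-- consists of those with i₁ < ⋯ < i_m; a (bounded-degree) formal power
-- series is given by its coefficient function on monomials, and all series
-- considered here have coefficient 0 on non-basis lists (unsorted θ-lists).

module Alphabet {a ℓ₁ ℓ₂ : Level} (S : StrictTotalOrder a ℓ₁ ℓ₂) where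
  open StrictTotalOrder S renaming (Carrier to A)

  Mono : Set a
  Mono = List A × List A

  Series : Set a
  Series = Mono → ℚ

  eqᵇ : A → A → Bool
  eqᵇ x y with compare x y
  ... | tri< _ _ _ = false
  ... | tri≈ _ _ _ = true
  ... | tri> _ _ _ = false

  memᵇ : A → List A → Bool
  memᵇ x [] = false
  memᵇ x (y ∷ ys) = if eqᵇ x y then true else memᵇ x ys

  insertSet : A → List A → List A
  insertSet x [] = x ∷ []
  insertSet x (y ∷ ys) with compare x y
  ... | tri< _ _ _ = x ∷ y ∷ ys
  ... | tri≈ _ _ _ = y ∷ ys
  ... | tri> _ _ _ = y ∷ insertSet x ys

  -- the index set of a monomial, listed increasingly (its order-preserving
  -- relabelling onto [k] sends the r-th entry to r)
  indexSet : Mono → List A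
  indexSet (t , w) = foldr insertSet [] (t ++ w)

  positionsFrom : ℕ → A → List A → List ℕ
  positionsFrom k x [] = []
  positionsFrom k x (y ∷ ys) =
    if eqᵇ x y then k ∷ positionsFrom (suc k) x ys else positionsFrom (suc k) x ys

  blockOf : Mono → A → Block
  blockOf (t , w) x = (if memᵇ x t then 0 ∷ [] else []) ++ positionsFrom 1 x w

  I[_] : Mono → SetSeq
  I[ u ] = map (blockOf u) (indexSet u)

  M : SetSeq → Series
  M I (t , w) =
    if ⌊ linked? {R = _<_} _<?_ t ×-dec ≡-dec (≡-dec ℕ._≟_) I[ t , w ] I ⌋ then 1ℚ else 0ℚ

-- The alphabet x₁ < x₂ < ⋯ (with θ₁,θ₂,…), and the combined alphabet
-- x₁ < x₂ < ⋯ < y₁ < y₂ < ⋯ (with θ₁ < ⋯ < ϑ₁ < ⋯); inj₁ i ↔ x_i/θ_i,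
-- inj₂ j ↔ y_j/ϑ_j.

module X  = Alphabet ℕₚ.<-strictTotalOrder
module XY = Alphabet (LO.⊎-<-strictTotalOrder {a = Level.zero} {b = Level.zero} {c = Level.zero} {d = Level.zero} {e = Level.zero} {f = Level.zero} ℕₚ.<-strictTotalOrder ℕₚ.<-strictTotalOrder)

-- Elements of Q^θ⟨⟨x⟩⟩ ⊗ Q^ϑ⟨⟨y⟩⟩, by their coefficients on the basis
-- u ⊗ v of pairs of monomials.
Tensor : Set
Tensor = X.Mono × X.Mono → ℚ

_⊗_ : X.Series → X.Series → Tensor
(f ⊗ g) (u , v) = f u * g v

sumℚ : List ℚ → ℚ
sumℚ = foldr _+_ 0ℚ

shuffles : {B : Set} → List B → List B → List (List B)
shuffles [] ys = ys ∷ []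
shuffles (x ∷ xs) [] = (x ∷ xs) ∷ []
shuffles (x ∷ xs) (y ∷ ys) =
  map (x ∷_) (shuffles xs (y ∷ ys)) ++ map (y ∷_) (shuffles (x ∷ xs) ys)

-- The image of a series F in Q^{θ,ϑ}⟨⟨x,y⟩⟩ modulo x_i y_j = y_j x_i,
-- identified with an element of the super tensor product:
-- θ_{t}ϑ_{t'} x_w y_{w'} ↦ θ_t x_w ⊗ ϑ_{t'} y_{w'}  (no sign arises), and the
-- coefficient of u ⊗ v is the sum of the coefficients of all monomials of
-- F mapping to it, i.e. θ-part θ_t ϑ_{t'} and word a shuffle of w and w'.
quotientImage : XY.Series → Tensor
quotientImage F ((t , w) , (t' , w')) =
  sumℚ (map (λ z → F (map inj₁ t ++ map inj₂ t' , z))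
            (shuffles (map inj₁ w) (map inj₂ w')))

-- Δ(M_I) = image of M_I(x,y;θ,ϑ)
ΔM : SetSeq → Tensor
ΔM I = quotientImage (XY.M I)

module Submission where

-- Renaming the letters of a monomial u = θ_t x_w by their ranks in its index set K (standardizing)
-- does not change I(u), and gives a monomial in the letters 0, …, |K| - 1.  For increasing t, t',
-- the coefficient of u ⊗ v in Δ(M_I) counts the shuffles z of x_w and y_w' with I(θ_t ϑ_t' z) = I.
-- Since every x-letter precedes every y-letter, θ_t ϑ_t' z standardizes to the θ-part
-- st(t) ++ (k₁ + st(t')) together with a shuffle of st(w) and k₁ + st(w'), where k₁ = |K|.
-- On the other side, I = I(θ_I c_I) for a unique standard monomial θ_I c_I in the letters below
-- length I, so the count is 1 exactly when the θ-parts agree and c_I splits into its letters below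
-- and above k₁ as st(w) and k₁ + st(w').  Cutting I after its first k₁ blocks and standardizing
-- both parts performs exactly this split, so the count is the term i = k₁ of the right-hand side;
-- every other term vanishes because std(I₁, …, I_i) has i blocks.

open import Defs
open import Level using (Level; 0ℓ)
open import Function using (_∘_; _⇔_; mk⇔; Equivalence)
import Function.Properties.Equivalence as ⇔
open import Data.Bool using (true; false; if_then_else_)
open import Data.Empty using (⊥-elim)
open import Data.Nat as ℕ using (ℕ; zero; suc; _+_; _∸_; _≤_; _<_; z≤n; s≤s)
import Data.Nat.Properties as ℕ
open import Data.Nat.ListAction using (sum)
open import Data.Fin using (Fin; toℕ; fromℕ<)
import Data.Fin as Fin
import Data.Fin.Properties as Fin
open import Data.Product using (_×_; _,_; proj₁; proj₂; ∃-syntax)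
open import Data.Sum using (_⊎_; inj₁; inj₂)
import Data.Sum.Relation.Binary.LeftOrder as LeftOrder
import Data.Sum.Relation.Binary.Pointwise as Pointwise
open import Data.List
  using (List; []; _∷_; _++_; map; length; foldr; concat; filter; take; drop; upTo; applyUpTo; lookup)
import Data.List.Properties as List
open import Data.List.Properties
  using ( take-[]; map-++; map-∘; map-cong; map-cong-local; map-upTo; map-applyUpTo; map-id; applyUpTo-∷ʳ
        ; length-applyUpTo; length-map; length-take; length-drop; length-++; length-filter
        ; filter-++; filter-accept; filter-reject; filter-all; filter-none; filter-≐
        ; ≡-dec; ∷-injective; ∷-injectiveˡ; ∷-injectiveʳ; ++-identityʳ )
open import Data.List.Membership.Propositional using (_∈_; _∉_)
open import Data.List.Membership.Propositional.Properties
  using (∈-++⁺ˡ; ∈-++⁺ʳ; ∈-++⁻; ∈-map⁺; ∈-map⁻; ∈-filter⁺; ∈-filter⁻; ∈-upTo⁺; ∈-upTo⁻)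
open import Data.List.Membership.DecPropositional ℕ._≟_ using (_∈?_)
open import Data.List.Relation.Unary.Any using (here; there)
open import Data.List.Relation.Unary.All as All using (All; []; _∷_)
open import Data.List.Relation.Unary.All.Properties
  using () renaming (map⁺ to All-map⁺; ++⁺ to All-++⁺; ++⁻ˡ to All-++⁻ˡ)
open import Data.List.Relation.Unary.AllPairs as AllPairs using (AllPairs; []; _∷_)
import Data.List.Relation.Unary.AllPairs.Properties as AllPairs
open import Data.List.Relation.Unary.Linked as Linked using (Linked; linked?)
open import Data.List.Relation.Unary.Linked.Properties using (Linked⇒AllPairs; AllPairs⇒Linked)
open import Data.List.Relation.Binary.BagAndSetEquality using (bag-=⇒; ↭⇒∼bag; ++-cong)
import Data.List.Relation.Binary.BagAndSetEquality as SetEq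
open import Data.List.Relation.Binary.Permutation.Propositional
  using (_↭_; prep; ↭-sym; ↭-trans; ↭-refl; module PermutationReasoning)
open import Data.List.Relation.Binary.Permutation.Propositional.Properties
  using (shift; shifts; ++⁺ˡ; ↭-empty-inv; All-resp-↭)
open import Data.Rational using (ℚ; 0ℚ; 1ℚ) renaming (_+_ to _+ℚ_; _*_ to _*ℚ_)
import Data.Rational.Properties as ℚ
open import Algebra.Bundles using (CommutativeMonoid)
open import Algebra.Properties.CommutativeSemigroup
  (CommutativeMonoid.commutativeSemigroup ℚ.*-1-commutativeMonoid) using (interchange)
open import Relation.Unary using (Decidable; ∁)
open import Relation.Unary.Properties using (∁?)
open import Relation.Binary using (StrictTotalOrder; tri<; tri≈; tri>; DecidableEquality)
open import Relation.Binary.PropositionalEquality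
  using (_≡_; _≢_; refl; sym; trans; cong; cong₂; subst; module ≡-Reasoning)
open import Relation.Nullary using (Dec; yes; no; ¬_)
open import Relation.Nullary.Decidable using (⌊_⌋; _×-dec_; ¬?)
open import Relation.Nullary.Reflects using (Reflects; ofʸ; ofⁿ)

private variable
  p : Level
  A B : Set
  P Q : Set p

applyUpTo-≡⁻ : ∀ (f g : ℕ → A) k → applyUpTo f k ≡ applyUpTo g k → ∀ j → j < k → f j ≡ g j
applyUpTo-≡⁻ f g (suc k) eq zero _ = ∷-injectiveˡ eq
applyUpTo-≡⁻ f g (suc k) eq (suc j) (s≤s j<k) = applyUpTo-≡⁻ (f ∘ suc) (g ∘ suc) k (∷-injectiveʳ eq) j j<k

applyUpTo-cong : ∀ {f g : ℕ → A} k → (∀ j → j < k → f j ≡ g j) → applyUpTo f k ≡ applyUpTo g k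
applyUpTo-cong zero _ = refl
applyUpTo-cong (suc k) f≗g = cong₂ _∷_ (f≗g 0 (s≤s z≤n)) (applyUpTo-cong k λ j j<k → f≗g (suc j) (s≤s j<k))

take-applyUpTo : ∀ (f : ℕ → A) {i k} → i ≤ k → take i (applyUpTo f k) ≡ applyUpTo f i
take-applyUpTo f z≤n = refl
take-applyUpTo f (s≤s i≤k) = cong (f 0 ∷_) (take-applyUpTo (f ∘ suc) i≤k)

drop-applyUpTo : ∀ (f : ℕ → A) i k → drop i (applyUpTo f k) ≡ applyUpTo (λ j → f (i + j)) (k ∸ i)
drop-applyUpTo f zero k = refl
drop-applyUpTo f (suc i) zero = refl
drop-applyUpTo f (suc i) (suc k) = drop-applyUpTo (f ∘ suc) i k

count : {P : A → Set p} → Decidable P → List A → ℕ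
count P? xs = length (filter P? xs)

count-++ : {P : A → Set p} (P? : Decidable P) (xs ys : List A) →
  count P? (xs ++ ys) ≡ count P? xs + count P? ys
count-++ P? xs ys = trans (cong length (filter-++ P? xs ys)) (length-++ (filter P? xs))

count-map : {P : B → Set p} (P? : Decidable P) (f : A → B) (xs : List A) →
  count P? (map f xs) ≡ count (P? ∘ f) xs
count-map P? f [] = refl
count-map P? f (x ∷ xs) with P? (f x)
... | yes _ = cong suc (count-map P? f xs)
... | no _ = count-map P? f xs

count-⊎ : {P Q R : A → Set p} (P? : Decidable P) (Q? : Decidable Q) (R? : Decidable R) →
  (∀ {x} → R x ⇔ (P x ⊎ Q x)) → (∀ {x} → P x → ¬ Q x) → ∀ xs → count P? xs + count Q? xs ≡ count R? xs
count-⊎ P? Q? R? R⇔P⊎Q disjoint [] = refl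
count-⊎ P? Q? R? R⇔P⊎Q disjoint (x ∷ xs) with P? x | Q? x | R? x
... | yes px | yes qx | _ = ⊥-elim (disjoint px qx)
... | yes _ | no _ | yes _ = cong suc (count-⊎ P? Q? R? R⇔P⊎Q disjoint xs)
... | no _ | yes _ | yes _ =
  trans (ℕ.+-suc (count P? xs) (count Q? xs)) (cong suc (count-⊎ P? Q? R? R⇔P⊎Q disjoint xs))
... | no _ | no _ | no _ = count-⊎ P? Q? R? R⇔P⊎Q disjoint xs
... | yes px | no _ | no ¬rx = ⊥-elim (¬rx (Equivalence.from R⇔P⊎Q (inj₁ px)))
... | no _ | yes qx | no ¬rx = ⊥-elim (¬rx (Equivalence.from R⇔P⊎Q (inj₂ qx)))
... | no ¬px | no ¬qx | yes rx with Equivalence.to R⇔P⊎Q rx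
...   | inj₁ px = ⊥-elim (¬px px)
...   | inj₂ qx = ⊥-elim (¬qx qx)

count-filter-concat : {P Q : A → Set p} (P? : Decidable P) (Q? : Decidable Q) (xss : List (List A)) →
  count P? (filter Q? (concat xss)) ≡ sum (map (count P? ∘ filter Q?) xss)
count-filter-concat P? Q? [] = refl
count-filter-concat P? Q? (xs ∷ xss) = begin
  count P? (filter Q? (xs ++ concat xss))
    ≡⟨ cong (count P?) (filter-++ Q? xs (concat xss)) ⟩
  count P? (filter Q? xs ++ filter Q? (concat xss))
    ≡⟨ cong length (filter-++ P? (filter Q? xs) (filter Q? (concat xss))) ⟩
  length (filter P? (filter Q? xs) ++ filter P? (filter Q? (concat xss)))
    ≡⟨ length-++ (filter P? (filter Q? xs)) ⟩
  count P? (filter Q? xs) + count P? (filter Q? (concat xss))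
    ≡⟨ cong (count P? (filter Q? xs) +_) (count-filter-concat P? Q? xss) ⟩
  count P? (filter Q? xs) + sum (map (count P? ∘ filter Q?) xss) ∎
  where open ≡-Reasoning

filter-≐-All : {P Q : A → Set p} (P? : Decidable P) (Q? : Decidable Q) {xs : List A} →
  All (λ x → P x ⇔ Q x) xs → filter P? xs ≡ filter Q? xs
filter-≐-All P? Q? [] = refl
filter-≐-All P? Q? {x ∷ xs} (Px⇔Qx ∷ P⇔Q) with P? x
... | yes Px = trans (cong (x ∷_) (filter-≐-All P? Q? P⇔Q)) (sym (filter-accept Q? (Equivalence.to Px⇔Qx Px)))
... | no ¬Px = trans (filter-≐-All P? Q? P⇔Q) (sym (filter-reject Q? (¬Px ∘ Equivalence.from Px⇔Qx)))

AllPairs-++⁻ : {R : A → A → Set p} (xs : List A) {ys : List A} →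
  AllPairs R (xs ++ ys) → AllPairs R xs × AllPairs R ys
AllPairs-++⁻ [] ys↗ = [] , ys↗
AllPairs-++⁻ (x ∷ xs) (x<xs++ys ∷ xs++ys↗) =
  let (xs↗ , ys↗) = AllPairs-++⁻ xs xs++ys↗ in (All-++⁻ˡ xs x<xs++ys ∷ xs↗) , ys↗

∸-suc-< : ∀ {s p} → s < p → p ∸ s ≡ suc (p ∸ suc s)
∸-suc-< {s} {suc p} (s≤s s≤p) = ℕ.+-∸-assoc 1 s≤p

map-∸-+ : ∀ k xs → map (_∸ k) (map (k +_) xs) ≡ xs
map-∸-+ k xs = trans (sym (map-∘ xs)) (trans (map-cong (ℕ.m+n∸m≡n k) xs) (map-id xs))

map-+-∸ : ∀ k {xs} → All (k ≤_) xs → map (k +_) (map (_∸ k) xs) ≡ xs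
map-+-∸ k {xs} k≤xs = trans (sym (map-∘ xs)) (trans (map-cong-local (All.map ℕ.m+[n∸m]≡n k≤xs)) (map-id xs))

-- The shape of the coefficients in M, so that M J u unfolds to an indicator.
𝟙 : Dec P → ℚ
𝟙 d = if ⌊ d ⌋ then 1ℚ else 0ℚ

𝟙-yes : (d : Dec P) → P → 𝟙 d ≡ 1ℚ
𝟙-yes (yes _) _ = refl
𝟙-yes (no ¬p) p = ⊥-elim (¬p p)

𝟙-no : (d : Dec P) → ¬ P → 𝟙 d ≡ 0ℚ
𝟙-no (yes p) ¬p = ⊥-elim (¬p p)
𝟙-no (no _) _ = refl

𝟙-cong : (d : Dec P) (e : Dec Q) → P ⇔ Q → 𝟙 d ≡ 𝟙 e
𝟙-cong (yes p) e P⇔Q = sym (𝟙-yes e (Equivalence.to P⇔Q p))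
𝟙-cong (no ¬p) e P⇔Q = sym (𝟙-no e (¬p ∘ Equivalence.from P⇔Q))

𝟙-× : (d : Dec P) (e : Dec Q) → 𝟙 (d ×-dec e) ≡ 𝟙 d *ℚ 𝟙 e
𝟙-× (yes _) (yes _) = refl
𝟙-× (yes _) (no _) = refl
𝟙-× (no _) (yes _) = refl
𝟙-× (no _) (no _) = refl

sumℚ-++ : ∀ xs ys → sumℚ (xs ++ ys) ≡ sumℚ xs +ℚ sumℚ ys
sumℚ-++ [] ys = sym (ℚ.+-identityˡ (sumℚ ys))
sumℚ-++ (x ∷ xs) ys = trans (cong (x +ℚ_) (sumℚ-++ xs ys)) (sym (ℚ.+-assoc x (sumℚ xs) (sumℚ ys)))

sumℚ-map-cong : {f g : A → ℚ} (xs : List A) → (∀ {x} → x ∈ xs → f x ≡ g x) → sumℚ (map f xs) ≡ sumℚ (map g xs)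
sumℚ-map-cong [] _ = refl
sumℚ-map-cong (x ∷ xs) f≗g = cong₂ _+ℚ_ (f≗g (here refl)) (sumℚ-map-cong xs (f≗g ∘ there))

sumℚ-map-zero : {f : A → ℚ} (xs : List A) → (∀ {x} → x ∈ xs → f x ≡ 0ℚ) → sumℚ (map f xs) ≡ 0ℚ
sumℚ-map-zero [] _ = refl
sumℚ-map-zero (x ∷ xs) f≗0 = cong₂ _+ℚ_ (f≗0 (here refl)) (sumℚ-map-zero xs (f≗0 ∘ there))

sumℚ-map-*ˡ : (a : ℚ) (f : A → ℚ) (xs : List A) → sumℚ (map (λ x → a *ℚ f x) xs) ≡ a *ℚ sumℚ (map f xs)
sumℚ-map-*ˡ a f [] = sym (ℚ.*-zeroʳ a)
sumℚ-map-*ˡ a f (x ∷ xs) =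
  trans (cong (a *ℚ f x +ℚ_) (sumℚ-map-*ˡ a f xs)) (sym (ℚ.*-distribˡ-+ a (f x) (sumℚ (map f xs))))

sumℚ-upTo-suc : (f : ℕ → ℚ) (m : ℕ) → sumℚ (map f (upTo (suc m))) ≡ sumℚ (map f (upTo m)) +ℚ f m
sumℚ-upTo-suc f m = begin
  sumℚ (map f (upTo (suc m)))          ≡⟨ cong (sumℚ ∘ map f) (sym (applyUpTo-∷ʳ (λ i → i) m)) ⟩
  sumℚ (map f (upTo m ++ m ∷ []))      ≡⟨ cong sumℚ (map-++ f (upTo m) (m ∷ [])) ⟩
  sumℚ (map f (upTo m) ++ f m ∷ [])    ≡⟨ sumℚ-++ (map f (upTo m)) (f m ∷ []) ⟩
  sumℚ (map f (upTo m)) +ℚ (f m +ℚ 0ℚ) ≡⟨ cong (sumℚ (map f (upTo m)) +ℚ_) (ℚ.+-identityʳ (f m)) ⟩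
  sumℚ (map f (upTo m)) +ℚ f m         ∎
  where open ≡-Reasoning

sumℚ-upTo-single : (f : ℕ → ℚ) {j : ℕ} (m : ℕ) → j < m → (∀ i → i < m → i ≢ j → f i ≡ 0ℚ) →
  sumℚ (map f (upTo m)) ≡ f j
sumℚ-upTo-single f {j} (suc m) j<1+m f≡0 with m ℕ.≟ j
... | yes refl = begin
  sumℚ (map f (upTo (suc j)))  ≡⟨ sumℚ-upTo-suc f j ⟩
  sumℚ (map f (upTo j)) +ℚ f j ≡⟨ cong (_+ℚ f j) (sumℚ-map-zero (upTo j) λ i∈ →
                                      f≡0 _ (ℕ.m<n⇒m<1+n (∈-upTo⁻ i∈)) (ℕ.<⇒≢ (∈-upTo⁻ i∈))) ⟩
  0ℚ +ℚ f j                    ≡⟨ ℚ.+-identityˡ (f j) ⟩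
  f j                          ∎
  where open ≡-Reasoning
... | no m≢j = begin
  sumℚ (map f (upTo (suc m)))  ≡⟨ sumℚ-upTo-suc f m ⟩
  sumℚ (map f (upTo m)) +ℚ f m ≡⟨ cong₂ _+ℚ_ (sumℚ-upTo-single f m j<m λ i i<m → f≡0 i (ℕ.m<n⇒m<1+n i<m))
                                              (f≡0 m ℕ.≤-refl m≢j) ⟩
  f j +ℚ 0ℚ                    ≡⟨ ℚ.+-identityʳ (f j) ⟩
  f j                          ∎
  where
  open ≡-Reasoning
  j<m : j < m
  j<m = ℕ.≤∧≢⇒< (ℕ.≤-pred j<1+m) (m≢j ∘ sym)

map-shuffles : (g : A → B) (xs ys : List A) → map (map g) (shuffles xs ys) ≡ shuffles (map g xs) (map g ys)
map-shuffles g [] ys = refl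
map-shuffles g (x ∷ xs) [] = refl
map-shuffles g (x ∷ xs) (y ∷ ys) = begin
  map (map g) (map (x ∷_) (shuffles xs (y ∷ ys)) ++ map (y ∷_) (shuffles (x ∷ xs) ys))
    ≡⟨ map-++ (map g) (map (x ∷_) (shuffles xs (y ∷ ys))) _ ⟩
  map (map g) (map (x ∷_) (shuffles xs (y ∷ ys))) ++ map (map g) (map (y ∷_) (shuffles (x ∷ xs) ys))
    ≡⟨ cong₂ _++_ (prepend x xs (y ∷ ys)) (prepend y (x ∷ xs) ys) ⟩
  map (g x ∷_) (shuffles (map g xs) (map g (y ∷ ys))) ++ map (g y ∷_) (shuffles (map g (x ∷ xs)) (map g ys)) ∎
  where
  open ≡-Reasoning
  prepend : ∀ z us vs → map (map g) (map (z ∷_) (shuffles us vs)) ≡ map (g z ∷_) (shuffles (map g us) (map g vs))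
  prepend z us vs = trans (sym (map-∘ (shuffles us vs)))
    (trans (map-∘ (shuffles us vs)) (cong (map (g z ∷_)) (map-shuffles g us vs)))

shuffles-↭ : ∀ {z : List A} xs ys → z ∈ shuffles xs ys → z ↭ xs ++ ys
shuffles-↭ [] ys (here refl) = ↭-refl
shuffles-↭ (x ∷ xs) [] (here refl) = subst ((x ∷ xs) ↭_) (sym (++-identityʳ (x ∷ xs))) ↭-refl
shuffles-↭ (x ∷ xs) (y ∷ ys) z∈ with ∈-++⁻ (map (x ∷_) (shuffles xs (y ∷ ys))) z∈
... | inj₁ z∈ˡ with _ , c∈ , refl ← ∈-map⁻ (x ∷_) z∈ˡ = prep x (shuffles-↭ xs (y ∷ ys) c∈)
... | inj₂ z∈ʳ with _ , c∈ , refl ← ∈-map⁻ (y ∷_) z∈ʳ =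
  ↭-trans (prep y (shuffles-↭ (x ∷ xs) ys c∈)) (↭-sym (shift y (x ∷ xs) ys))

sumℚ-shuffles-∷ : (g : List A → ℚ) (x y : A) (xs ys : List A) →
  sumℚ (map g (shuffles (x ∷ xs) (y ∷ ys)))
    ≡ sumℚ (map (g ∘ (x ∷_)) (shuffles xs (y ∷ ys))) +ℚ sumℚ (map (g ∘ (y ∷_)) (shuffles (x ∷ xs) ys))
sumℚ-shuffles-∷ g x y xs ys = begin
  sumℚ (map g (map (x ∷_) S₁ ++ map (y ∷_) S₂))
    ≡⟨ cong sumℚ (map-++ g (map (x ∷_) S₁) (map (y ∷_) S₂)) ⟩
  sumℚ (map g (map (x ∷_) S₁) ++ map g (map (y ∷_) S₂))
    ≡⟨ sumℚ-++ (map g (map (x ∷_) S₁)) (map g (map (y ∷_) S₂)) ⟩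
  sumℚ (map g (map (x ∷_) S₁)) +ℚ sumℚ (map g (map (y ∷_) S₂))
    ≡⟨ cong₂ _+ℚ_ (cong sumℚ (sym (map-∘ S₁))) (cong sumℚ (sym (map-∘ S₂))) ⟩
  sumℚ (map (g ∘ (x ∷_)) S₁) +ℚ sumℚ (map (g ∘ (y ∷_)) S₂) ∎
  where
  open ≡-Reasoning
  S₁ = shuffles xs (y ∷ ys)
  S₂ = shuffles (x ∷ xs) ys

module ShuffleCount {P : A → Set p} (P? : Decidable P) (_≟_ : DecidableEquality A) where

  private
    _≟ₗ_ : DecidableEquality (List A)
    _≟ₗ_ = ≡-dec _≟_

  Split : List A → List A → List A → Set
  Split a b C = a ≡ filter P? C × b ≡ filter (∁? P?) C

  split? : ∀ a b C → Dec (Split a b C)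
  split? a b C = a ≟ₗ filter P? C ×-dec b ≟ₗ filter (∁? P?) C

  𝟙-∷ : ∀ x z (xs C : List A) → 𝟙 ((x ∷ xs) ≟ₗ (z ∷ C)) ≡ 𝟙 (x ≟ z) *ℚ 𝟙 (xs ≟ₗ C)
  𝟙-∷ x z xs C = trans (𝟙-cong _ (x ≟ z ×-dec xs ≟ₗ C) (mk⇔ ∷-injective λ { (refl , refl) → refl }))
                       (𝟙-× (x ≟ z) (xs ≟ₗ C))

  filter-∁-of-empty : ∀ C → filter P? C ≡ [] → filter (∁? P?) C ≡ C
  filter-∁-of-empty [] _ = refl
  filter-∁-of-empty (z ∷ C) e with P? z
  ... | no _ = cong (z ∷_) (filter-∁-of-empty C e)

  filter-of-∁-empty : ∀ C → filter (∁? P?) C ≡ [] → filter P? C ≡ C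
  filter-of-∁-empty [] _ = refl
  filter-of-∁-empty (z ∷ C) e with P? z
  ... | yes _ = cong (z ∷_) (filter-of-∁-empty C e)

  split-[]ˡ : ∀ b C → All (∁ P) b → b ≡ C ⇔ Split [] b C
  split-[]ˡ b C ¬Pb = mk⇔ (λ { refl → sym (filter-none P? ¬Pb) , sym (filter-all (∁? P?) ¬Pb) })
    λ (e₁ , e₂) → trans e₂ (filter-∁-of-empty C (sym e₁))

  split-[]ʳ : ∀ a C → All P a → a ≡ C ⇔ Split a [] C
  split-[]ʳ a C Pa =
    mk⇔ (λ { refl → sym (filter-all P? Pa) , sym (filter-none (∁? P?) (All.map (λ p ¬p → ¬p p) Pa)) })
    λ (e₁ , e₂) → trans e₁ (filter-of-∁-empty C (sym e₂))

  split-∷ˡ : ∀ {x z a b C} → P z → (x ≡ z × Split a b C) ⇔ Split (x ∷ a) b (z ∷ C)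
  split-∷ˡ {x} {z} {a} {b} {C} pz = mk⇔
    (λ { (refl , a≡ , b≡) → trans (cong (z ∷_) a≡) (sym accept) , trans b≡ (sym reject) })
    λ (e₁ , e₂) → let (x≡z , a≡) = ∷-injective (trans e₁ accept) in x≡z , a≡ , trans e₂ reject
    where
    accept : filter P? (z ∷ C) ≡ z ∷ filter P? C
    accept = filter-accept P? {xs = C} pz
    reject : filter (∁? P?) (z ∷ C) ≡ filter (∁? P?) C
    reject = filter-reject (∁? P?) {xs = C} (λ ¬pz → ¬pz pz)

  split-∷ʳ : ∀ {y z a b C} → ¬ P z → (y ≡ z × Split a b C) ⇔ Split a (y ∷ b) (z ∷ C)
  split-∷ʳ {y} {z} {a} {b} {C} ¬pz = mk⇔
    (λ { (refl , a≡ , b≡) → trans a≡ (sym reject) , trans (cong (z ∷_) b≡) (sym accept) })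
    λ (e₁ , e₂) → let (y≡z , b≡) = ∷-injective (trans e₂ accept) in y≡z , trans e₁ reject , b≡
    where
    accept : filter (∁? P?) (z ∷ C) ≡ z ∷ filter (∁? P?) C
    accept = filter-accept (∁? P?) {xs = C} ¬pz
    reject : filter P? (z ∷ C) ≡ filter P? C
    reject = filter-reject P? {xs = C} ¬pz

  𝟙-split-∷ : ∀ {x y z a b C} → P x → ¬ P y →
    𝟙 (x ≟ z) *ℚ 𝟙 (split? a (y ∷ b) C) +ℚ 𝟙 (y ≟ z) *ℚ 𝟙 (split? (x ∷ a) b C)
      ≡ 𝟙 (split? (x ∷ a) (y ∷ b) (z ∷ C))
  𝟙-split-∷ {x} {y} {z} {a} {b} {C} px ¬py = by-first-letter (P? z)
    where
    open ≡-Reasoning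
    σ₁ σ₂ : ℚ
    σ₁ = 𝟙 (split? a (y ∷ b) C)
    σ₂ = 𝟙 (split? (x ∷ a) b C)
    by-first-letter : Dec (P z) → 𝟙 (x ≟ z) *ℚ σ₁ +ℚ 𝟙 (y ≟ z) *ℚ σ₂ ≡ 𝟙 (split? (x ∷ a) (y ∷ b) (z ∷ C))
    by-first-letter (yes pz) = begin
      𝟙 (x ≟ z) *ℚ σ₁ +ℚ 𝟙 (y ≟ z) *ℚ σ₂
        ≡⟨ cong (λ t → 𝟙 (x ≟ z) *ℚ σ₁ +ℚ t *ℚ σ₂) (𝟙-no (y ≟ z) λ { refl → ¬py pz }) ⟩
      𝟙 (x ≟ z) *ℚ σ₁ +ℚ 0ℚ *ℚ σ₂
        ≡⟨ trans (cong (𝟙 (x ≟ z) *ℚ σ₁ +ℚ_) (ℚ.*-zeroˡ σ₂)) (ℚ.+-identityʳ _) ⟩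
      𝟙 (x ≟ z) *ℚ σ₁
        ≡⟨ sym (𝟙-× (x ≟ z) (split? a (y ∷ b) C)) ⟩
      𝟙 (x ≟ z ×-dec split? a (y ∷ b) C)
        ≡⟨ 𝟙-cong _ (split? (x ∷ a) (y ∷ b) (z ∷ C)) (split-∷ˡ pz) ⟩
      𝟙 (split? (x ∷ a) (y ∷ b) (z ∷ C)) ∎
    by-first-letter (no ¬pz) = begin
      𝟙 (x ≟ z) *ℚ σ₁ +ℚ 𝟙 (y ≟ z) *ℚ σ₂
        ≡⟨ cong (λ t → t *ℚ σ₁ +ℚ 𝟙 (y ≟ z) *ℚ σ₂) (𝟙-no (x ≟ z) λ { refl → ¬pz px }) ⟩
      0ℚ *ℚ σ₁ +ℚ 𝟙 (y ≟ z) *ℚ σ₂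
        ≡⟨ trans (cong (_+ℚ 𝟙 (y ≟ z) *ℚ σ₂) (ℚ.*-zeroˡ σ₁)) (ℚ.+-identityˡ _) ⟩
      𝟙 (y ≟ z) *ℚ σ₂
        ≡⟨ sym (𝟙-× (y ≟ z) (split? (x ∷ a) b C)) ⟩
      𝟙 (y ≟ z ×-dec split? (x ∷ a) b C)
        ≡⟨ 𝟙-cong _ (split? (x ∷ a) (y ∷ b) (z ∷ C)) (split-∷ʳ ¬pz) ⟩
      𝟙 (split? (x ∷ a) (y ∷ b) (z ∷ C)) ∎

  -- Only the split of C into its P- and ∁P-letters interleaves back to C, and in exactly one way.
  count-shuffles : ∀ a b C → All P a → All (∁ P) b →
    sumℚ (map (λ c → 𝟙 (c ≟ₗ C)) (shuffles a b)) ≡ 𝟙 (split? a b C)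
  count-shuffles [] b C _ ¬Pb = trans (ℚ.+-identityʳ _) (𝟙-cong (b ≟ₗ C) (split? [] b C) (split-[]ˡ b C ¬Pb))
  count-shuffles (x ∷ a) [] C Pa _ =
    trans (ℚ.+-identityʳ _) (𝟙-cong ((x ∷ a) ≟ₗ C) (split? (x ∷ a) [] C) (split-[]ʳ (x ∷ a) C Pa))
  count-shuffles (x ∷ a) (y ∷ b) [] _ _ =
    trans (sumℚ-map-zero (shuffles (x ∷ a) (y ∷ b)) λ c∈ → 𝟙-no (_ ≟ₗ []) λ { refl → nonempty c∈ })
          (sym (𝟙-no (split? (x ∷ a) (y ∷ b) []) λ { (() , _) }))
    where
    nonempty : [] ∉ shuffles (x ∷ a) (y ∷ b)
    nonempty []∈ with () ← ↭-empty-inv (↭-sym (shuffles-↭ (x ∷ a) (y ∷ b) []∈))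
  count-shuffles (x ∷ a) (y ∷ b) (z ∷ C) Pxa@(px ∷ Pa) ¬Pyb@(¬py ∷ ¬Pb) = begin
    sumℚ (map (λ c → 𝟙 (c ≟ₗ (z ∷ C))) (shuffles (x ∷ a) (y ∷ b)))
      ≡⟨ sumℚ-shuffles-∷ (λ c → 𝟙 (c ≟ₗ (z ∷ C))) x y a b ⟩
    sumℚ (map (λ c → 𝟙 ((x ∷ c) ≟ₗ (z ∷ C))) S₁) +ℚ sumℚ (map (λ c → 𝟙 ((y ∷ c) ≟ₗ (z ∷ C))) S₂)
      ≡⟨ cong₂ _+ℚ_ (headed x S₁) (headed y S₂) ⟩
    𝟙 (x ≟ z) *ℚ sumℚ (map (λ c → 𝟙 (c ≟ₗ C)) S₁) +ℚ 𝟙 (y ≟ z) *ℚ sumℚ (map (λ c → 𝟙 (c ≟ₗ C)) S₂)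
      ≡⟨ cong₂ (λ s t → 𝟙 (x ≟ z) *ℚ s +ℚ 𝟙 (y ≟ z) *ℚ t)
               (count-shuffles a (y ∷ b) C Pa ¬Pyb) (count-shuffles (x ∷ a) b C Pxa ¬Pb) ⟩
    𝟙 (x ≟ z) *ℚ 𝟙 (split? a (y ∷ b) C) +ℚ 𝟙 (y ≟ z) *ℚ 𝟙 (split? (x ∷ a) b C)
      ≡⟨ 𝟙-split-∷ px ¬py ⟩
    𝟙 (split? (x ∷ a) (y ∷ b) (z ∷ C)) ∎
    where
    open ≡-Reasoning
    S₁ S₂ : List (List A)
    S₁ = shuffles a (y ∷ b)
    S₂ = shuffles (x ∷ a) b
    headed : ∀ u S → sumℚ (map (λ c → 𝟙 ((u ∷ c) ≟ₗ (z ∷ C))) S) ≡ 𝟙 (u ≟ z) *ℚ sumℚ (map (λ c → 𝟙 (c ≟ₗ C)) S)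
    headed u S = trans (sumℚ-map-cong S λ {c} _ → 𝟙-∷ u z c C) (sumℚ-map-*ˡ (𝟙 (u ≟ z)) (λ c → 𝟙 (c ≟ₗ C)) S)

-- Ordered alphabets and standardization

-- I(u) when the index set of u is {0, …, k - 1}.
blocksOf : ℕ → X.Mono → SetSeq
blocksOf k u = applyUpTo (X.blockOf u) k

Reflects-⇔ : ∀ {b c} → Reflects P b → Reflects Q c → P ⇔ Q → b ≡ c
Reflects-⇔ (ofʸ p) (ofʸ q) _ = refl
Reflects-⇔ (ofʸ p) (ofⁿ ¬q) P⇔Q = ⊥-elim (¬q (Equivalence.to P⇔Q p))
Reflects-⇔ (ofⁿ ¬p) (ofʸ q) P⇔Q = ⊥-elim (¬p (Equivalence.from P⇔Q q))
Reflects-⇔ (ofⁿ ¬p) (ofⁿ ¬q) _ = refl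

module OrderedAlphabet {a ℓ₁ ℓ₂ : Level} (S : StrictTotalOrder a ℓ₁ ℓ₂)
  (≈⇒≡ : ∀ {x y} → StrictTotalOrder._≈_ S x y → x ≡ y) where

  open StrictTotalOrder S renaming (Carrier to Letter; _<_ to _≺_; _<?_ to _≺?_; trans to ≺-trans)
  open Alphabet S

  ≺-irrefl : ∀ {x} → ¬ x ≺ x
  ≺-irrefl = irrefl Eq.refl

  eqᵇ-reflects : ∀ x y → Reflects (x ≡ y) (eqᵇ x y)
  eqᵇ-reflects x y with compare x y
  ... | tri< x≺y _ _ = ofⁿ λ { refl → ≺-irrefl x≺y }
  ... | tri≈ _ x≈y _ = ofʸ (≈⇒≡ x≈y)
  ... | tri> _ _ y≺x = ofⁿ λ { refl → ≺-irrefl y≺x }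

  memᵇ-reflects : ∀ x ys → Reflects (x ∈ ys) (memᵇ x ys)
  memᵇ-reflects x [] = ofⁿ λ ()
  memᵇ-reflects x (y ∷ ys) with eqᵇ x y | eqᵇ-reflects x y
  ... | true | ofʸ x≡y = ofʸ (here x≡y)
  ... | false | ofⁿ x≢y with memᵇ x ys | memᵇ-reflects x ys
  ...   | true | ofʸ x∈ys = ofʸ (there x∈ys)
  ...   | false | ofⁿ x∉ys = ofⁿ λ { (here x≡y) → x≢y x≡y ; (there x∈ys) → x∉ys x∈ys }

  eqᵇ-refl : ∀ x → eqᵇ x x ≡ true
  eqᵇ-refl x with eqᵇ x x | eqᵇ-reflects x x
  ... | true | _ = refl
  ... | false | ofⁿ x≢x = ⊥-elim (x≢x refl)

  eqᵇ⇒≡ : ∀ {x y} → eqᵇ x y ≡ true → x ≡ y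
  eqᵇ⇒≡ {x} {y} eq with eqᵇ x y | eqᵇ-reflects x y
  ... | true | ofʸ x≡y = x≡y

  Sorted : List Letter → Set _
  Sorted = AllPairs _≺_

  insertSet-sorted : ∀ x ys → Sorted ys → Sorted (insertSet x ys)
  insertSet-sorted x [] [] = [] ∷ []
  insertSet-sorted x (y ∷ ys) (y≺ys ∷ ys↗) with compare x y
  ... | tri< x≺y _ _ = (x≺y ∷ All.map (≺-trans x≺y) y≺ys) ∷ y≺ys ∷ ys↗
  ... | tri≈ _ _ _ = y≺ys ∷ ys↗
  ... | tri> _ _ y≺x = insert-bound ys y≺x y≺ys ∷ insertSet-sorted x ys ys↗
    where
    insert-bound : ∀ zs → y ≺ x → All (y ≺_) zs → All (y ≺_) (insertSet x zs)
    insert-bound [] y≺x [] = y≺x ∷ []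
    insert-bound (z ∷ zs) y≺x (y≺z ∷ y≺zs) with compare x z
    ... | tri< _ _ _ = y≺x ∷ y≺z ∷ y≺zs
    ... | tri≈ _ _ _ = y≺z ∷ y≺zs
    ... | tri> _ _ _ = y≺z ∷ insert-bound zs y≺x y≺zs

  ∈-insertSet : ∀ {z} x ys → z ∈ insertSet x ys ⇔ (z ≡ x ⊎ z ∈ ys)
  ∈-insertSet x [] = mk⇔ (λ { (here z≡x) → inj₁ z≡x }) λ { (inj₁ z≡x) → here z≡x }
  ∈-insertSet x (y ∷ ys) with compare x y
  ... | tri< _ _ _ = mk⇔ (λ { (here z≡x) → inj₁ z≡x ; (there z∈) → inj₂ z∈ })
                         λ { (inj₁ z≡x) → here z≡x ; (inj₂ z∈) → there z∈ }
  ... | tri≈ _ x≈y _ = mk⇔ inj₂ λ { (inj₁ refl) → here (≈⇒≡ x≈y) ; (inj₂ z∈) → z∈ }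
  ... | tri> _ _ _ = mk⇔
    (λ { (here z≡y) → inj₂ (here z≡y)
       ; (there z∈) → Data.Sum.map₂ there (Equivalence.to (∈-insertSet x ys) z∈) })
    λ { (inj₂ (here z≡y)) → here z≡y
      ; (inj₂ (there z∈)) → there (Equivalence.from (∈-insertSet x ys) (inj₂ z∈))
      ; (inj₁ z≡x) → there (Equivalence.from (∈-insertSet x ys) (inj₁ z≡x)) }

  indexSet-sorted : ∀ u → Sorted (indexSet u)
  indexSet-sorted (t , w) = foldr-sorted (t ++ w)
    where
    foldr-sorted : ∀ xs → Sorted (foldr insertSet [] xs)
    foldr-sorted [] = []
    foldr-sorted (x ∷ xs) = insertSet-sorted x _ (foldr-sorted xs)

  ∈-indexSet : ∀ {z} t w → z ∈ indexSet (t , w) ⇔ z ∈ t ++ w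
  ∈-indexSet {z} t w = ∈-foldr (t ++ w)
    where
    ∈-foldr : ∀ xs → z ∈ foldr insertSet [] xs ⇔ z ∈ xs
    ∈-foldr [] = mk⇔ (λ ()) (λ ())
    ∈-foldr (x ∷ xs) = mk⇔ to from
      where
      to : z ∈ insertSet x (foldr insertSet [] xs) → z ∈ x ∷ xs
      to z∈ with Equivalence.to (∈-insertSet x (foldr insertSet [] xs)) z∈
      ... | inj₁ z≡x = here z≡x
      ... | inj₂ z∈′ = there (Equivalence.to (∈-foldr xs) z∈′)
      from : z ∈ x ∷ xs → z ∈ insertSet x (foldr insertSet [] xs)
      from (here z≡x) = Equivalence.from (∈-insertSet x (foldr insertSet [] xs)) (inj₁ z≡x)
      from (there z∈) =
        Equivalence.from (∈-insertSet x (foldr insertSet [] xs)) (inj₂ (Equivalence.from (∈-foldr xs) z∈))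

  sorted-≡ : ∀ {xs ys} → Sorted xs → Sorted ys → (∀ {z} → z ∈ xs ⇔ z ∈ ys) → xs ≡ ys
  sorted-≡ {[]} {[]} _ _ _ = refl
  sorted-≡ {[]} {y ∷ ys} _ _ same with () ← Equivalence.from same (here refl)
  sorted-≡ {x ∷ xs} {[]} _ _ same with () ← Equivalence.to same (here refl)
  sorted-≡ {x ∷ xs} {y ∷ ys} (x≺xs ∷ xs↗) (y≺ys ∷ ys↗) same =
    cong₂ _∷_ x≡y (sorted-≡ xs↗ ys↗ (mk⇔ (tail x≡y x≺xs (Equivalence.to same))
                                        (tail (sym x≡y) y≺ys (Equivalence.from same))))
    where
    x≡y : x ≡ y
    x≡y with Equivalence.to same (here refl) | Equivalence.from same (here refl)
    ... | here x≡y | _ = x≡y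
    ... | there _ | here y≡x = sym y≡x
    ... | there x∈ys | there y∈xs = ⊥-elim (≺-irrefl (≺-trans (All.lookup y≺ys x∈ys) (All.lookup x≺xs y∈xs)))
    tail : ∀ {u v us vs} → u ≡ v → All (u ≺_) us → (∀ {z} → z ∈ u ∷ us → z ∈ v ∷ vs) → ∀ {z} → z ∈ us → z ∈ vs
    tail refl u≺us sub z∈ with sub (there z∈)
    ... | there z∈vs = z∈vs
    ... | here refl = ⊥-elim (≺-irrefl (All.lookup u≺us z∈))

module ℕ-Alphabet = OrderedAlphabet ℕ.<-strictTotalOrder (λ x≡y → x≡y)

module Standardization {a ℓ₁ ℓ₂ : Level} (S : StrictTotalOrder a ℓ₁ ℓ₂)
  (≈⇒≡ : ∀ {x y} → StrictTotalOrder._≈_ S x y → x ≡ y) where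

  open StrictTotalOrder S renaming (Carrier to Letter; _<_ to _≺_; _<?_ to _≺?_; trans to ≺-trans)
  open Alphabet S
  open OrderedAlphabet S ≈⇒≡

  rank : List Letter → Letter → ℕ
  rank K x = length (filter (_≺? x) K)

  rank-∷-≺ : ∀ {y x} K → y ≺ x → rank (y ∷ K) x ≡ suc (rank K x)
  rank-∷-≺ K y≺x = cong length (filter-accept (_≺? _) {xs = K} y≺x)

  rank-∷-⊀ : ∀ {y x} K → ¬ y ≺ x → rank (y ∷ K) x ≡ rank K x
  rank-∷-⊀ K y⊀x = cong length (filter-reject (_≺? _) {xs = K} y⊀x)

  rank-sorted : ∀ K → Sorted K → map (rank K) K ≡ upTo (length K)
  rank-sorted [] [] = refl
  rank-sorted (y ∷ K) (y≺K ∷ K↗) = cong₂ _∷_ rank-head (begin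
    map (rank (y ∷ K)) K          ≡⟨ map-cong-local (All.map (rank-∷-≺ K) y≺K) ⟩
    map (suc ∘ rank K) K          ≡⟨ map-∘ K ⟩
    map suc (map (rank K) K)      ≡⟨ cong (map suc) (rank-sorted K K↗) ⟩
    map suc (upTo (length K))     ≡⟨ map-upTo suc (length K) ⟩
    applyUpTo suc (length K)      ∎)
    where
    open ≡-Reasoning
    rank-head : rank (y ∷ K) y ≡ 0
    rank-head = trans (rank-∷-⊀ K ≺-irrefl) (cong length (filter-none (_≺? y) (All.map asym y≺K)))

  rank-mono : ∀ {x y} K → x ≺ y → rank K x ≤ rank K y
  rank-mono [] _ = z≤n
  rank-mono {x} {y} (z ∷ K) x≺y with z ≺? x | z ≺? y
  ... | yes _ | yes _ = s≤s (rank-mono K x≺y)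
  ... | yes z≺x | no z⊀y = ⊥-elim (z⊀y (≺-trans z≺x x≺y))
  ... | no _ | yes _ = ℕ.m≤n⇒m≤1+n (rank-mono K x≺y)
  ... | no _ | no _ = rank-mono K x≺y

  rank-strict : ∀ {x y} K → x ∈ K → x ≺ y → rank K x < rank K y
  rank-strict {x} {y} (z ∷ K) x∈ x≺y with z ≺? x | z ≺? y | x∈
  ... | yes z≺x | _ | here refl = ⊥-elim (≺-irrefl z≺x)
  ... | no _ | yes _ | here refl = s≤s (rank-mono K x≺y)
  ... | _ | no z⊀y | here refl = ⊥-elim (z⊀y x≺y)
  ... | yes _ | yes _ | there x∈K = s≤s (rank-strict K x∈K x≺y)
  ... | yes z≺x | no z⊀y | there _ = ⊥-elim (z⊀y (≺-trans z≺x x≺y))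
  ... | no _ | yes _ | there x∈K = ℕ.m≤n⇒m≤1+n (rank-strict K x∈K x≺y)
  ... | no _ | no _ | there x∈K = rank-strict K x∈K x≺y

  rank-bound : ∀ {x} K → x ∈ K → rank K x < length K
  rank-bound {x} (z ∷ K) x∈ with z ≺? x | x∈
  ... | yes z≺x | here refl = ⊥-elim (≺-irrefl z≺x)
  ... | no _ | here refl = s≤s (length-filter (_≺? x) K)
  ... | yes _ | there x∈K = s≤s (rank-bound K x∈K)
  ... | no _ | there x∈K = ℕ.m≤n⇒m≤1+n (rank-bound K x∈K)

  rank-bound-map : ∀ K xs → (∀ {x} → x ∈ xs → x ∈ K) → All (_< length K) (map (rank K) xs)
  rank-bound-map K xs xs⊆K = All-map⁺ (All.tabulate (rank-bound K ∘ xs⊆K))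

  rank-injective : ∀ {x y} K → x ∈ K → y ∈ K → rank K x ≡ rank K y → x ≡ y
  rank-injective {x} {y} K x∈ y∈ rx≡ry with compare x y
  ... | tri< x≺y _ _ = ⊥-elim (ℕ.<⇒≢ (rank-strict K x∈ x≺y) rx≡ry)
  ... | tri≈ _ x≈y _ = ≈⇒≡ x≈y
  ... | tri> _ _ y≺x = ⊥-elim (ℕ.<⇒≢ (rank-strict K y∈ y≺x) (sym rx≡ry))

  module _ (f : Letter → ℕ) {x : Letter} where

    InjectiveAt : List Letter → Set a
    InjectiveAt ys = ∀ {y} → y ∈ ys → f x ≡ f y → x ≡ y

    eqᵇ-map : ∀ {y} → (f x ≡ f y → x ≡ y) → eqᵇ x y ≡ X.eqᵇ (f x) (f y)
    eqᵇ-map inj = Reflects-⇔ (eqᵇ-reflects x _) (ℕ-Alphabet.eqᵇ-reflects (f x) _) (mk⇔ (cong f) inj)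

    memᵇ-map : ∀ t → InjectiveAt t → memᵇ x t ≡ X.memᵇ (f x) (map f t)
    memᵇ-map t inj = Reflects-⇔ (memᵇ-reflects x t) (ℕ-Alphabet.memᵇ-reflects (f x) (map f t))
      (mk⇔ (∈-map⁺ f) λ fx∈ → let (y , y∈ , fx≡fy) = ∈-map⁻ f fx∈ in subst (_∈ t) (sym (inj y∈ fx≡fy)) y∈)

    positionsFrom-map : ∀ s w → InjectiveAt w → positionsFrom s x w ≡ X.positionsFrom s (f x) (map f w)
    positionsFrom-map s [] _ = refl
    positionsFrom-map s (y ∷ w) inj rewrite eqᵇ-map (inj (here refl)) with X.eqᵇ (f x) (f y)
    ... | true = cong (s ∷_) (positionsFrom-map (suc s) w (inj ∘ there))
    ... | false = positionsFrom-map (suc s) w (inj ∘ there)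

    blockOf-map : ∀ t w → InjectiveAt (t ++ w) → blockOf (t , w) x ≡ X.blockOf (map f t , map f w) (f x)
    blockOf-map t w inj =
      cong₂ (λ b ps → (if b then 0 ∷ [] else []) ++ ps)
        (memᵇ-map t (inj ∘ ∈-++⁺ˡ)) (positionsFrom-map 1 w (inj ∘ ∈-++⁺ʳ t))

  I-standardized : ∀ t w → let K = indexSet (t , w) in
    I[ t , w ] ≡ blocksOf (length K) (map (rank K) t , map (rank K) w)
  I-standardized t w = begin
    map (blockOf (t , w)) K
      ≡⟨ map-cong-local (All.tabulate λ x∈ → blockOf-map (rank K) t w (injectiveAt x∈)) ⟩
    map (X.blockOf st ∘ rank K) K
      ≡⟨ map-∘ K ⟩
    map (X.blockOf st) (map (rank K) K)
      ≡⟨ cong (map (X.blockOf st)) (rank-sorted K (indexSet-sorted (t , w))) ⟩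
    map (X.blockOf st) (upTo (length K))
      ≡⟨ map-upTo (X.blockOf st) (length K) ⟩
    blocksOf (length K) st ∎
    where
    open ≡-Reasoning
    K : List Letter
    K = indexSet (t , w)
    st : X.Mono
    st = map (rank K) t , map (rank K) w
    injectiveAt : ∀ {x} → x ∈ K → InjectiveAt (rank K) (t ++ w)
    injectiveAt x∈ y∈ = rank-injective K x∈ (Equivalence.from (∈-indexSet t w) y∈)

module ℕ-Standardization = Standardization ℕ.<-strictTotalOrder (λ x≡y → x≡y)

positionsFrom-≥ : ∀ s j c → All (s ≤_) (X.positionsFrom s j c)
positionsFrom-≥ s j [] = []
positionsFrom-≥ s j (x ∷ c) with X.eqᵇ j x
... | true = ℕ.≤-refl ∷ All.map ℕ.<⇒≤ (positionsFrom-≥ (suc s) j c)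
... | false = All.map ℕ.<⇒≤ (positionsFrom-≥ (suc s) j c)

positionsFrom-sorted : ∀ s j c → AllPairs _<_ (X.positionsFrom s j c)
positionsFrom-sorted s j [] = []
positionsFrom-sorted s j (x ∷ c) with X.eqᵇ j x
... | true = positionsFrom-≥ (suc s) j c ∷ positionsFrom-sorted (suc s) j c
... | false = positionsFrom-sorted (suc s) j c

positionsFrom-head : ∀ {s xs} j c → X.positionsFrom (suc s) j c ≢ s ∷ xs
positionsFrom-head {s} j c eq with positionsFrom-≥ (suc s) j c
... | s<ps rewrite eq with s<ps
... | s<s ∷ _ = ℕ.<-irrefl refl s<s

positionsFrom-occurs : ∀ s x c → X.positionsFrom s x (x ∷ c) ≢ []
positionsFrom-occurs s x c eq rewrite ℕ-Alphabet.eqᵇ-refl x with () ← eq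

positionsFrom-∷-≡⁻ : ∀ s j x x' c c' → X.positionsFrom s j (x ∷ c) ≡ X.positionsFrom s j (x' ∷ c') →
  X.eqᵇ j x ≡ X.eqᵇ j x' × X.positionsFrom (suc s) j c ≡ X.positionsFrom (suc s) j c'
positionsFrom-∷-≡⁻ s j x x' c c' eq with X.eqᵇ j x | X.eqᵇ j x'
... | true | true = refl , ∷-injectiveʳ eq
... | false | false = refl , eq
... | true | false = ⊥-elim (positionsFrom-head j c' (sym eq))
... | false | true = ⊥-elim (positionsFrom-head j c eq)

positionsFrom-injective : ∀ k s c c' → (∀ j → j < k → X.positionsFrom s j c ≡ X.positionsFrom s j c') →
  All (_< k) c → All (_< k) c' → c ≡ c'
positionsFrom-injective k s [] [] _ _ _ = refl
positionsFrom-injective k s (x ∷ c) [] same (x<k ∷ _) _ =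
  ⊥-elim (positionsFrom-occurs s x c (same x x<k))
positionsFrom-injective k s [] (x' ∷ c') same _ (x'<k ∷ _) =
  ⊥-elim (positionsFrom-occurs s x' c' (sym (same x' x'<k)))
positionsFrom-injective k s (x ∷ c) (x' ∷ c') same (x<k ∷ c<k) (_ ∷ c'<k) =
  cong₂ _∷_ x≡x' (positionsFrom-injective k (suc s) c c' (λ j j<k → proj₂ (split j j<k)) c<k c'<k)
  where
  split : ∀ j → j < k → X.eqᵇ j x ≡ X.eqᵇ j x' × X.positionsFrom (suc s) j c ≡ X.positionsFrom (suc s) j c'
  split j j<k = positionsFrom-∷-≡⁻ s j x x' c c' (same j j<k)
  x≡x' : x ≡ x'
  x≡x' = ℕ-Alphabet.eqᵇ⇒≡ (trans (sym (proj₁ (split x x<k))) (ℕ-Alphabet.eqᵇ-refl x))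

blockOf-≡⁻ : ∀ j Θ c Θ' c' → X.blockOf (Θ , c) j ≡ X.blockOf (Θ' , c') j →
  X.memᵇ j Θ ≡ X.memᵇ j Θ' × X.positionsFrom 1 j c ≡ X.positionsFrom 1 j c'
blockOf-≡⁻ j Θ c Θ' c' eq with X.memᵇ j Θ | X.memᵇ j Θ'
... | true | true = refl , ∷-injectiveʳ eq
... | false | false = refl , eq
... | true | false = ⊥-elim (positionsFrom-head j c' (sym eq))
... | false | true = ⊥-elim (positionsFrom-head j c eq)

length-blocksOf : ∀ k u → length (blocksOf k u) ≡ k
length-blocksOf k u = length-applyUpTo (X.blockOf u) k

AgreeBelow : ℕ → List ℕ → List ℕ → Set
AgreeBelow k Θ Θ' = ∀ j → j < k → X.memᵇ j Θ ≡ X.memᵇ j Θ'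

blocksOf-length : ∀ {k k' u u'} → blocksOf k u ≡ blocksOf k' u' → k ≡ k'
blocksOf-length {k} {k'} {u} {u'} eq =
  trans (sym (length-blocksOf k u)) (trans (cong length eq) (length-blocksOf k' u'))

blocksOf-injective : ∀ {k Θ c Θ' c'} → All (_< k) c → All (_< k) c' →
  blocksOf k (Θ , c) ≡ blocksOf k (Θ' , c') → AgreeBelow k Θ Θ' × c ≡ c'
blocksOf-injective {k} {Θ} {c} {Θ'} {c'} c<k c'<k eq =
  (λ j j<k → proj₁ (same j j<k)) , positionsFrom-injective k 1 c c' (λ j j<k → proj₂ (same j j<k)) c<k c'<k
  where
  same : ∀ j → j < k → X.memᵇ j Θ ≡ X.memᵇ j Θ' × X.positionsFrom 1 j c ≡ X.positionsFrom 1 j c'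
  same j j<k = blockOf-≡⁻ j Θ c Θ' c' (applyUpTo-≡⁻ (X.blockOf (Θ , c)) (X.blockOf (Θ' , c')) k eq j j<k)

blocksOf-cong : ∀ {k} Θ Θ' c → AgreeBelow k Θ Θ' → blocksOf k (Θ , c) ≡ blocksOf k (Θ' , c)
blocksOf-cong {k} Θ Θ' c agree =
  applyUpTo-cong k λ j j<k → cong (λ b → (if b then 0 ∷ [] else []) ++ X.positionsFrom 1 j c) (agree j j<k)

blocksOf-≡-⇔ : ∀ {k Θ c Θ' c'} → All (_< k) c → All (_< k) c' →
  blocksOf k (Θ , c) ≡ blocksOf k (Θ' , c') ⇔ (AgreeBelow k Θ Θ' × c ≡ c')
blocksOf-≡-⇔ {Θ = Θ} {c} {Θ'} c<k c'<k =
  mk⇔ (blocksOf-injective {Θ = Θ} {Θ' = Θ'} c<k c'<k) λ { (agree , refl) → blocksOf-cong Θ Θ' c agree }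

∈-blockOf : ∀ {a} j Θ c → a ∈ X.blockOf (Θ , c) j ⇔ ((a ≡ 0 × j ∈ Θ) ⊎ a ∈ X.positionsFrom 1 j c)
∈-blockOf j Θ c with X.memᵇ j Θ | ℕ-Alphabet.memᵇ-reflects j Θ
... | true | ofʸ j∈Θ = mk⇔ (λ { (here a≡0) → inj₁ (a≡0 , j∈Θ) ; (there a∈) → inj₂ a∈ })
                          λ { (inj₁ (a≡0 , _)) → here a≡0 ; (inj₂ a∈) → there a∈ }
... | false | ofⁿ j∉Θ = mk⇔ inj₂ λ { (inj₁ (_ , j∈Θ)) → ⊥-elim (j∉Θ j∈Θ) ; (inj₂ a∈) → a∈ }

blockOf-sorted : ∀ j Θ c → AllPairs _<_ (X.blockOf (Θ , c) j)
blockOf-sorted j Θ c with X.memᵇ j Θ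
... | true = positionsFrom-≥ 1 j c ∷ positionsFrom-sorted 1 j c
... | false = positionsFrom-sorted 1 j c

-- Decoding a set supercomposition

letters : (ℕ → ℕ) → ℕ → ℕ → List ℕ
letters f s zero = []
letters f s (suc n) = f s ∷ letters f (suc s) n

∈-positionsFrom-letters : ∀ f j s n {a} → a ∈ X.positionsFrom s j (letters f s n) ⇔ (s ≤ a × a < s + n × f a ≡ j)
∈-positionsFrom-letters f j s n = mk⇔ (to s n) (from s n)
  where
  widen : ∀ {s n a} → suc s ≤ a × a < suc s + n × f a ≡ j → s ≤ a × a < s + suc n × f a ≡ j
  widen {s} {n} {a} (s<a , a<s+n , fa≡j) = ℕ.<⇒≤ s<a , subst (a <_) (sym (ℕ.+-suc s n)) a<s+n , fa≡j
  to : ∀ s n {a} → a ∈ X.positionsFrom s j (letters f s n) → s ≤ a × a < s + n × f a ≡ j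
  to s (suc n) a∈ with X.eqᵇ j (f s) | ℕ-Alphabet.eqᵇ-reflects j (f s) | a∈
  ... | true | ofʸ j≡fs | here refl = ℕ.≤-refl , ℕ.m<m+n s ℕ.z<s , sym j≡fs
  ... | true | _ | there a∈′ = widen (to (suc s) n a∈′)
  ... | false | _ | a∈′ = widen (to (suc s) n a∈′)
  from : ∀ s n {a} → s ≤ a × a < s + n × f a ≡ j → a ∈ X.positionsFrom s j (letters f s n)
  from s zero (s≤a , a<s+0 , _) =
    ⊥-elim (ℕ.<-irrefl refl (ℕ.<-≤-trans a<s+0 (subst (_≤ _) (sym (ℕ.+-identityʳ s)) s≤a)))
  from s (suc n) {a} (s≤a , a<s+n , fa≡j) with X.eqᵇ j (f s) | ℕ-Alphabet.eqᵇ-reflects j (f s) | ℕ.m≤n⇒m<n∨m≡n s≤a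
  ... | true | _ | inj₂ refl = here refl
  ... | false | ofⁿ j≢fs | inj₂ refl = ⊥-elim (j≢fs (sym fa≡j))
  ... | true | _ | inj₁ s<a = there (from (suc s) n (s<a , subst (a <_) (ℕ.+-suc s n) a<s+n , fa≡j))
  ... | false | _ | inj₁ s<a = from (suc s) n (s<a , subst (a <_) (ℕ.+-suc s n) a<s+n , fa≡j)

All-letters : ∀ {P : ℕ → Set} f s n → (∀ a → s ≤ a → a < s + n → P (f a)) → All P (letters f s n)
All-letters f s zero _ = []
All-letters f s (suc n) Pf =
  Pf s ℕ.≤-refl (ℕ.m<m+n s ℕ.z<s) ∷
  All-letters f (suc s) n λ a s<a a<s+n → Pf a (ℕ.<⇒≤ s<a) (subst (a <_) (sym (ℕ.+-suc s n)) a<s+n)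

blockAt : SetSeq → ℕ → Block
blockAt [] _ = []
blockAt (B ∷ I) zero = B
blockAt (B ∷ I) (suc j) = blockAt I j

-- Equals length I when a lies in no block; only used for covered a.
blockIndex : SetSeq → ℕ → ℕ
blockIndex [] a = 0
blockIndex (B ∷ I) a with a ∈? B
... | yes _ = 0
... | no _ = suc (blockIndex I a)

applyUpTo-blockAt : ∀ I → applyUpTo (blockAt I) (length I) ≡ I
applyUpTo-blockAt [] = refl
applyUpTo-blockAt (B ∷ I) = cong (B ∷_) (applyUpTo-blockAt I)

lookup-blockAt : ∀ I (i : Fin (length I)) → lookup I i ≡ blockAt I (toℕ i)
lookup-blockAt (B ∷ I) Fin.zero = refl
lookup-blockAt (B ∷ I) (Fin.suc i) = lookup-blockAt I i

blockAt-exists : ∀ {B} I → B ∈ I → ∃[ j ] blockAt I j ≡ B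
blockAt-exists (B ∷ I) (here refl) = 0 , refl
blockAt-exists (B ∷ I) (there B∈) with j , eq ← blockAt-exists I B∈ = suc j , eq

All-blockAt : ∀ {P : Block → Set} I j → All P I → P [] → P (blockAt I j)
All-blockAt [] j [] P[] = P[]
All-blockAt (B ∷ I) zero (PB ∷ _) _ = PB
All-blockAt (B ∷ I) (suc j) (_ ∷ PI) P[] = All-blockAt I j PI P[]

blockAt-bound : ∀ {a} I j → a ∈ blockAt I j → j < length I
blockAt-bound (B ∷ I) zero _ = s≤s z≤n
blockAt-bound (B ∷ I) (suc j) a∈ = s≤s (blockAt-bound I j a∈)

blockIndex-found : ∀ I a → blockIndex I a < length I → a ∈ blockAt I (blockIndex I a)
blockIndex-found (B ∷ I) a bound with a ∈? B
... | yes a∈B = a∈B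
... | no _ = blockIndex-found I a (ℕ.≤-pred bound)

blockIndex-first : ∀ I a j → a ∈ blockAt I j → blockIndex I a ≤ j
blockIndex-first (B ∷ I) a j a∈ with a ∈? B
... | yes _ = z≤n
blockIndex-first (B ∷ I) a zero a∈ | no a∉B = ⊥-elim (a∉B a∈)
blockIndex-first (B ∷ I) a (suc j) a∈ | no _ = s≤s (blockIndex-first I a j a∈)

fermionicBlocks : SetSeq → List ℕ
fermionicBlocks I = filter (λ j → 0 ∈? blockAt I j) (upTo (length I))

∈-fermionicBlocks : ∀ I j → j ∈ fermionicBlocks I ⇔ 0 ∈ blockAt I j
∈-fermionicBlocks I j = mk⇔
  (λ j∈ → proj₂ (∈-filter⁻ (λ i → 0 ∈? blockAt I i) {xs = upTo (length I)} j∈))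
  (λ 0∈ → ∈-filter⁺ (λ i → 0 ∈? blockAt I i) (∈-upTo⁺ (blockAt-bound I j 0∈)) 0∈)

-- θ-part: the blocks containing 0; letter a: the block containing a.
standardMonomial : ℕ → SetSeq → X.Mono
standardMonomial n I = fermionicBlocks I , letters (blockIndex I) 1 n

module _ {n : ℕ} {I : SetSeq} (sc : IsSetSupercomposition n I) where
  open IsSetSupercomposition sc

  blocks-disjoint : ∀ {a j j'} → j < length I → j' < length I → j ≢ j' → a ∈ blockAt I j → a ∈ blockAt I j' → a ≡ 0
  blocks-disjoint {a} j<k j'<k j≢j' a∈ a∈' =
    disjoint (fromℕ< j<k) (fromℕ< j'<k) (j≢j' ∘ Fin.fromℕ<-injective _ _ j<k j'<k)
             a (asLookup j<k a∈) (asLookup j'<k a∈')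
    where
    asLookup : ∀ {i} (i<k : i < length I) → a ∈ blockAt I i → a ∈ lookup I (fromℕ< i<k)
    asLookup {i} i<k =
      subst (a ∈_) (sym (trans (lookup-blockAt I (fromℕ< i<k)) (cong (blockAt I) (Fin.toℕ-fromℕ< i<k))))

  blockIndex-nonzero : ∀ {a} j → j < length I → suc a ∈ blockAt I j → blockIndex I (suc a) ≡ j
  blockIndex-nonzero {a} j j<k a∈ with ℕ.m≤n⇒m<n∨m≡n (blockIndex-first I (suc a) j a∈)
  ... | inj₂ index≡j = index≡j
  ... | inj₁ index<j
    with () ← blocks-disjoint (ℕ.<-trans index<j j<k) j<k (ℕ.<⇒≢ index<j)
                (blockIndex-found I (suc a) (ℕ.<-trans index<j j<k)) a∈

  blockWord-bound : All (_< length I) (proj₂ (standardMonomial n I))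
  blockWord-bound = All-letters (blockIndex I) 1 n λ a 1≤a a<1+n →
    let (B , B∈I , a∈B) = covering a 1≤a (ℕ.≤-pred a<1+n)
        (j , blockAt≡B) = blockAt-exists I B∈I
        a∈ = subst (a ∈_) (sym blockAt≡B) a∈B
    in ℕ.≤-<-trans (blockIndex-first I a j a∈) (blockAt-bound I j a∈)

  blocksOf-standardMonomial : blocksOf (length I) (standardMonomial n I) ≡ I
  blocksOf-standardMonomial = trans (applyUpTo-cong (length I) block-correct) (applyUpTo-blockAt I)
    where
    θ c : List ℕ
    θ = fermionicBlocks I
    c = letters (blockIndex I) 1 n
    block-correct : ∀ j → j < length I → X.blockOf (θ , c) j ≡ blockAt I j
    block-correct j j<k = ℕ-Alphabet.sorted-≡ (blockOf-sorted j θ c)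
      (Linked⇒AllPairs ℕ.<-trans (All-blockAt I j canonical Linked.[]))
      (mk⇔ (to ∘ Equivalence.to (∈-blockOf j θ c)) (Equivalence.from (∈-blockOf j θ c) ∘ from))
      where
      to : ∀ {a} → (a ≡ 0 × j ∈ θ) ⊎ a ∈ X.positionsFrom 1 j c → a ∈ blockAt I j
      to (inj₁ (refl , j∈θ)) = Equivalence.to (∈-fermionicBlocks I j) j∈θ
      to {a} (inj₂ a∈) with _ , _ , index≡j ← Equivalence.to (∈-positionsFrom-letters (blockIndex I) j 1 n) a∈ =
        subst (λ i → a ∈ blockAt I i) index≡j (blockIndex-found I a (subst (_< length I) (sym index≡j) j<k))
      from : ∀ {a} → a ∈ blockAt I j → (a ≡ 0 × j ∈ θ) ⊎ a ∈ X.positionsFrom 1 j c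
      from {zero} 0∈ = inj₁ (refl , Equivalence.from (∈-fermionicBlocks I j) 0∈)
      from {suc a} a∈ = inj₂ (Equivalence.from (∈-positionsFrom-letters (blockIndex I) j 1 n)
        (s≤s z≤n , s≤s (All.lookup (All-blockAt I j bounded []) a∈) , blockIndex-nonzero j j<k a∈))

-- Standardizing a window of blocks

InRange : ℕ → ℕ → ℕ → Set
InRange i m x = i ≤ x × x < i + m

inRange? : ∀ i m → Decidable (InRange i m)
inRange? i m x = i ℕ.≤? x ×-dec x ℕ.<? i + m

sum-count-inRange : ∀ i m xs → sum (applyUpTo (λ j → count (ℕ._≟ (i + j)) xs) m) ≡ count (inRange? i m) xs
sum-count-inRange i zero xs =
  sym (cong length (filter-none (inRange? i 0) {xs = xs} (All.tabulate λ {x} _ (i≤x , x<i+0) →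
    ℕ.<-irrefl refl (ℕ.<-≤-trans x<i+0 (subst (_≤ x) (sym (ℕ.+-identityʳ i)) i≤x)))))
sum-count-inRange i (suc m) xs = begin
  count (ℕ._≟ (i + 0)) xs + sum (applyUpTo (λ j → count (ℕ._≟ (i + suc j)) xs) m)
    ≡⟨ cong₂ (λ i′ s → count (ℕ._≟ i′) xs + s) (ℕ.+-identityʳ i)
             (cong sum (applyUpTo-cong m λ j _ → cong (λ i′ → count (ℕ._≟ i′) xs) (ℕ.+-suc i j))) ⟩
  count (ℕ._≟ i) xs + sum (applyUpTo (λ j → count (ℕ._≟ (suc i + j)) xs) m)
    ≡⟨ cong (count (ℕ._≟ i) xs +_) (sum-count-inRange (suc i) m xs) ⟩
  count (ℕ._≟ i) xs + count (inRange? (suc i) m) xs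
    ≡⟨ count-⊎ (ℕ._≟ i) (inRange? (suc i) m) (inRange? i (suc m))
               (mk⇔ split join) (λ { refl (i<i , _) → ℕ.<-irrefl refl i<i }) xs ⟩
  count (inRange? i (suc m)) xs ∎
  where
  open ≡-Reasoning
  split : ∀ {x} → InRange i (suc m) x → x ≡ i ⊎ InRange (suc i) m x
  split {x} (i≤x , x<i+1+m) with ℕ.m≤n⇒m<n∨m≡n i≤x
  ... | inj₂ refl = inj₁ refl
  ... | inj₁ i<x = inj₂ (i<x , subst (x <_) (ℕ.+-suc i m) x<i+1+m)
  join : ∀ {x} → x ≡ i ⊎ InRange (suc i) m x → InRange i (suc m) x
  join (inj₁ refl) = ℕ.≤-refl , ℕ.m<m+n i ℕ.z<s
  join {x} (inj₂ (i<x , x<1+i+m)) = ℕ.<⇒≤ i<x , subst (x <_) (sym (ℕ.+-suc i m)) x<1+i+m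

filter-<-positionsFrom : ∀ p s j c →
  filter (ℕ._<? p) (X.positionsFrom s j c) ≡ X.positionsFrom s j (take (p ∸ s) c)
filter-<-positionsFrom p s j [] rewrite take-[] {A = ℕ} (p ∸ s) = refl
filter-<-positionsFrom p s j (x ∷ c) with s ℕ.<? p
... | no s≮p rewrite ℕ.m≤n⇒m∸n≡0 (ℕ.≮⇒≥ s≮p) =
  filter-none (ℕ._<? p) (All.map (λ s≤q q<p → s≮p (ℕ.≤-<-trans s≤q q<p)) (positionsFrom-≥ s j (x ∷ c)))
... | yes s<p rewrite ∸-suc-< s<p with X.eqᵇ j x
...   | true = trans (filter-accept (ℕ._<? p) s<p) (cong (s ∷_) (filter-<-positionsFrom p (suc s) j c))
...   | false = filter-<-positionsFrom p (suc s) j c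

length-positionsFrom : ∀ s j c → length (X.positionsFrom s j c) ≡ count (ℕ._≟ j) c
length-positionsFrom s j [] = refl
length-positionsFrom s j (x ∷ c) with X.eqᵇ j x | ℕ-Alphabet.eqᵇ-reflects j x
... | true | ofʸ refl =
  trans (cong suc (length-positionsFrom (suc s) j c)) (sym (cong length (filter-accept (ℕ._≟ j) {xs = c} refl)))
... | false | ofⁿ j≢x =
  trans (length-positionsFrom (suc s) j c) (sym (cong length (filter-reject (ℕ._≟ j) {xs = c} (j≢x ∘ sym))))

positionsFrom-map-cong : ∀ {f g : ℕ → ℕ} s j c → (∀ {p} → s ≤ p → f p ≡ g p) →
  map f (X.positionsFrom s j c) ≡ map g (X.positionsFrom s j c)
positionsFrom-map-cong s j c f≗g = map-cong-local (All.map f≗g (positionsFrom-≥ s j c))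

module _ {R : ℕ → Set} (R? : Decidable R) {x s p : ℕ} (s' : ℕ) (c : List ℕ) (s<p : s < p) where

  private
    take-∷ : count R? (take (p ∸ s) (x ∷ c)) ≡ count R? (x ∷ take (p ∸ suc s) c)
    take-∷ = cong (λ d → count R? (take d (x ∷ c))) (∸-suc-< s<p)

  count-take-accept : R x → s' + count R? (take (p ∸ s) (x ∷ c)) ≡ suc s' + count R? (take (p ∸ suc s) c)
  count-take-accept Rx = trans (cong (s' +_) (trans take-∷ (cong length (filter-accept R? Rx)))) (ℕ.+-suc s' _)

  count-take-reject : ¬ R x → s' + count R? (take (p ∸ s) (x ∷ c)) ≡ s' + count R? (take (p ∸ suc s) c)
  count-take-reject ¬Rx = cong (s' +_) (trans take-∷ (cong length (filter-reject R? ¬Rx)))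

-- A position in c, renumbered by the number of R-letters before it, becomes its position in filter R? c.
positionsFrom-filter : {R : ℕ → Set} (R? : Decidable R) {j : ℕ} → R j → ∀ s s' c →
  map (λ p → s' + count R? (take (p ∸ s) c)) (X.positionsFrom s j c) ≡ X.positionsFrom s' j (filter R? c)
positionsFrom-filter R? Rj s s' [] = refl
positionsFrom-filter R? {j} Rj s s' (x ∷ c) with R? x
... | yes Rx with X.eqᵇ j x
...   | true = cong₂ _∷_
  (trans (cong (λ d → s' + count R? (take d (x ∷ c))) (ℕ.n∸n≡0 s)) (ℕ.+-identityʳ s'))
  (trans (positionsFrom-map-cong (suc s) j c λ s<p → count-take-accept R? s' c s<p Rx)
         (positionsFrom-filter R? Rj (suc s) (suc s') c))
...   | false =
  trans (positionsFrom-map-cong (suc s) j c λ s<p → count-take-accept R? s' c s<p Rx)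
        (positionsFrom-filter R? Rj (suc s) (suc s') c)
positionsFrom-filter R? {j} Rj s s' (x ∷ c) | no ¬Rx with X.eqᵇ j x | ℕ-Alphabet.eqᵇ-reflects j x
... | true | ofʸ refl = ⊥-elim (¬Rx Rj)
... | false | _ =
  trans (positionsFrom-map-cong (suc s) j c λ s<p → count-take-reject R? s' c s<p ¬Rx)
        (positionsFrom-filter R? Rj (suc s) s' c)

window : ℕ → ℕ → List ℕ → List ℕ
window i m xs = map (_∸ i) (filter (inRange? i m) xs)

windowBlocks : ℕ → ℕ → X.Mono → SetSeq
windowBlocks i m u = applyUpTo (λ j → X.blockOf u (i + j)) m

memᵇ-window : ∀ i m j xs → j < m → X.memᵇ (i + j) xs ≡ X.memᵇ j (window i m xs)
memᵇ-window i m j xs j<m =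
  Reflects-⇔ (ℕ-Alphabet.memᵇ-reflects (i + j) xs) (ℕ-Alphabet.memᵇ-reflects j (window i m xs)) (mk⇔ to from)
  where
  to : i + j ∈ xs → j ∈ window i m xs
  to i+j∈ = subst (_∈ window i m xs) (ℕ.m+n∸m≡n i j)
    (∈-map⁺ (_∸ i) (∈-filter⁺ (inRange? i m) i+j∈ (ℕ.m≤m+n i j , ℕ.+-monoʳ-< i j<m)))
  from : j ∈ window i m xs → i + j ∈ xs
  from j∈ with y , y∈ , refl ← ∈-map⁻ (_∸ i) j∈ with y∈xs , (i≤y , _) ← ∈-filter⁻ (inRange? i m) {xs = xs} y∈ =
    subst (_∈ xs) (sym (ℕ.m+[n∸m]≡n i≤y)) y∈xs

nonzero? : Decidable (λ (a : ℕ) → a ≢ 0)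
nonzero? a = ¬? (a ℕ.≟ 0)

-- The renaming of letters that std performs in its where clause.
stdRank : SetSeq → ℕ → ℕ
stdRank J zero = zero
stdRank J p@(suc _) = suc (count (ℕ._<? p) (filter nonzero? (concat J)))

std-stdRank : ∀ J → std J ≡ map (map (stdRank J)) J
std-stdRank J = map-cong (map-cong λ { zero → refl ; (suc _) → refl }) J

positions-nonzero : ∀ j c → filter nonzero? (X.positionsFrom 1 j c) ≡ X.positionsFrom 1 j c
positions-nonzero j c = filter-all nonzero? (All.map (λ { (s≤s _) () }) (positionsFrom-≥ 1 j c))

filter-nonzero-blockOf : ∀ j Θ c → filter nonzero? (X.blockOf (Θ , c) j) ≡ X.positionsFrom 1 j c
filter-nonzero-blockOf j Θ c with X.memᵇ j Θ
... | true = trans (filter-reject nonzero? {xs = X.positionsFrom 1 j c} (λ 0≢0 → 0≢0 refl)) (positions-nonzero j c)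
... | false = positions-nonzero j c

module _ (i m : ℕ) (Θ c : List ℕ) where

  private
    J : SetSeq
    J = windowBlocks i m (Θ , c)

  stdRank-windowBlocks : ∀ {p} → 1 ≤ p → stdRank J p ≡ 1 + count (inRange? i m) (take (p ∸ 1) c)
  stdRank-windowBlocks {suc p} _ = cong suc (begin
    count (ℕ._<? suc p) (filter nonzero? (concat J))
      ≡⟨ count-filter-concat (ℕ._<? suc p) nonzero? J ⟩
    sum (map (count (ℕ._<? suc p) ∘ filter nonzero?) J)
      ≡⟨ cong sum (map-applyUpTo (λ j → X.blockOf (Θ , c) (i + j)) _ m) ⟩
    sum (applyUpTo (λ j → count (ℕ._<? suc p) (filter nonzero? (X.blockOf (Θ , c) (i + j)))) m)
      ≡⟨ cong sum (applyUpTo-cong m λ j _ → in-block (i + j)) ⟩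
    sum (applyUpTo (λ j → count (ℕ._≟ (i + j)) (take p c)) m)
      ≡⟨ sum-count-inRange i m (take p c) ⟩
    count (inRange? i m) (take p c) ∎)
    where
    open ≡-Reasoning
    in-block : ∀ j → count (ℕ._<? suc p) (filter nonzero? (X.blockOf (Θ , c) j)) ≡ count (ℕ._≟ j) (take p c)
    in-block j = begin
      count (ℕ._<? suc p) (filter nonzero? (X.blockOf (Θ , c) j))
        ≡⟨ cong (count (ℕ._<? suc p)) (filter-nonzero-blockOf j Θ c) ⟩
      count (ℕ._<? suc p) (X.positionsFrom 1 j c)
        ≡⟨ cong length (filter-<-positionsFrom (suc p) 1 j c) ⟩
      length (X.positionsFrom 1 j (take p c))
        ≡⟨ length-positionsFrom 1 j (take p c) ⟩
      count (ℕ._≟ j) (take p c) ∎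

  positionsFrom-windowBlocks : ∀ j → j < m →
    map (stdRank J) (X.positionsFrom 1 (i + j) c) ≡ X.positionsFrom 1 j (window i m c)
  positionsFrom-windowBlocks j j<m = begin
    map (stdRank J) (X.positionsFrom 1 (i + j) c)
      ≡⟨ positionsFrom-map-cong 1 (i + j) c stdRank-windowBlocks ⟩
    map (λ p → 1 + count (inRange? i m) (take (p ∸ 1) c)) (X.positionsFrom 1 (i + j) c)
      ≡⟨ positionsFrom-filter (inRange? i m) (ℕ.m≤m+n i j , ℕ.+-monoʳ-< i j<m) 1 1 c ⟩
    X.positionsFrom 1 (i + j) (filter (inRange? i m) c)
      ≡⟨ ℕ-Standardization.positionsFrom-map (_∸ i) 1 (filter (inRange? i m) c) shift-injective ⟩
    X.positionsFrom 1 (i + j ∸ i) (window i m c)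
      ≡⟨ cong (λ j′ → X.positionsFrom 1 j′ (window i m c)) (ℕ.m+n∸m≡n i j) ⟩
    X.positionsFrom 1 j (window i m c) ∎
    where
    open ≡-Reasoning
    shift-injective : ℕ-Standardization.InjectiveAt (_∸ i) (filter (inRange? i m) c)
    shift-injective y∈ = ℕ.∸-cancelʳ-≡ (ℕ.m≤m+n i j) (proj₁ (proj₂ (∈-filter⁻ (inRange? i m) {xs = c} y∈)))

  std-windowBlocks : std J ≡ blocksOf m (window i m Θ , window i m c)
  std-windowBlocks = begin
    std J
      ≡⟨ std-stdRank J ⟩
    map (map (stdRank J)) J
      ≡⟨ map-applyUpTo (λ j → X.blockOf (Θ , c) (i + j)) _ m ⟩
    applyUpTo (λ j → map (stdRank J) (X.blockOf (Θ , c) (i + j))) m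
      ≡⟨ applyUpTo-cong m in-block ⟩
    blocksOf m (window i m Θ , window i m c) ∎
    where
    open ≡-Reasoning
    fermionic : ∀ b → map (stdRank J) (if b then 0 ∷ [] else []) ≡ (if b then 0 ∷ [] else [])
    fermionic true = refl
    fermionic false = refl
    in-block : ∀ j → j < m →
      map (stdRank J) (X.blockOf (Θ , c) (i + j)) ≡ X.blockOf (window i m Θ , window i m c) j
    in-block j j<m = trans (map-++ (stdRank J) (if X.memᵇ (i + j) Θ then 0 ∷ [] else []) _)
      (cong₂ _++_ (trans (fermionic (X.memᵇ (i + j) Θ))
                         (cong (λ b → if b then 0 ∷ [] else []) (memᵇ-window i m j Θ j<m)))
                  (positionsFrom-windowBlocks j j<m))

std-take-blocksOf : ∀ {k₁ K} θ c → k₁ ≤ K →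
  std (take k₁ (blocksOf K (θ , c))) ≡ blocksOf k₁ (window 0 k₁ θ , window 0 k₁ c)
std-take-blocksOf {k₁} θ c k₁≤K =
  trans (cong std (take-applyUpTo (X.blockOf (θ , c)) k₁≤K)) (std-windowBlocks 0 k₁ θ c)

std-drop-blocksOf : ∀ k₁ k₂ θ c →
  std (drop k₁ (blocksOf (k₁ + k₂) (θ , c))) ≡ blocksOf k₂ (window k₁ k₂ θ , window k₁ k₂ c)
std-drop-blocksOf k₁ k₂ θ c = begin
  std (drop k₁ (blocksOf (k₁ + k₂) (θ , c)))
    ≡⟨ cong std (drop-applyUpTo (X.blockOf (θ , c)) k₁ (k₁ + k₂)) ⟩
  std (applyUpTo (λ j → X.blockOf (θ , c) (k₁ + j)) (k₁ + k₂ ∸ k₁))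
    ≡⟨ cong (λ m → std (windowBlocks k₁ m (θ , c))) (ℕ.m+n∸m≡n k₁ k₂) ⟩
  std (windowBlocks k₁ k₂ (θ , c))                    ≡⟨ std-windowBlocks k₁ k₂ θ c ⟩
  blocksOf k₂ (window k₁ k₂ θ , window k₁ k₂ c)       ∎
  where open ≡-Reasoning

length-std-take : ∀ {i K} u → i ≤ K → length (std (take i (blocksOf K u))) ≡ i
length-std-take {i} {K} u i≤K = begin
  length (std (take i (blocksOf K u))) ≡⟨ length-map (map _) (take i (blocksOf K u)) ⟩
  length (take i (blocksOf K u))       ≡⟨ length-take i (blocksOf K u) ⟩
  i ℕ.⊓ length (blocksOf K u)          ≡⟨ cong (i ℕ.⊓_) (length-blocksOf K u) ⟩
  i ℕ.⊓ K                              ≡⟨ ℕ.m≤n⇒m⊓n≡m i≤K ⟩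
  i                                    ∎
  where open ≡-Reasoning

length-std-drop : ∀ i K u → length (std (drop i (blocksOf K u))) ≡ K ∸ i
length-std-drop i K u = begin
  length (std (drop i (blocksOf K u))) ≡⟨ length-map (map _) (drop i (blocksOf K u)) ⟩
  length (drop i (blocksOf K u))       ≡⟨ length-drop i (blocksOf K u) ⟩
  length (blocksOf K u) ∸ i            ≡⟨ cong (_∸ i) (length-blocksOf K u) ⟩
  K ∸ i                                ∎
  where open ≡-Reasoning

window-bound : ∀ i m xs → All (_< m) (window i m xs)
window-bound i m xs = All-map⁺ (All.tabulate λ {x} x∈ →
  let (_ , i≤x , x<i+m) = ∈-filter⁻ (inRange? i m) {xs = xs} x∈
  in ℕ.+-cancelˡ-< i (x ∸ i) m (subst (_< i + m) (sym (ℕ.m+[n∸m]≡n i≤x)) x<i+m))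

-- Splitting a standardized monomial in two

memᵇ-++-low : ∀ {k₁ j} θ₁ θ₂ → j < k₁ → X.memᵇ j (θ₁ ++ map (k₁ +_) θ₂) ≡ X.memᵇ j θ₁
memᵇ-++-low {k₁} {j} θ₁ θ₂ j<k₁ =
  Reflects-⇔ (ℕ-Alphabet.memᵇ-reflects j _) (ℕ-Alphabet.memᵇ-reflects j θ₁) (mk⇔ to ∈-++⁺ˡ)
  where
  to : j ∈ θ₁ ++ map (k₁ +_) θ₂ → j ∈ θ₁
  to j∈ with ∈-++⁻ θ₁ j∈
  ... | inj₁ j∈θ₁ = j∈θ₁
  ... | inj₂ j∈θ₂ with y , _ , refl ← ∈-map⁻ (k₁ +_) j∈θ₂ =
    ⊥-elim (ℕ.<-irrefl refl (ℕ.<-≤-trans j<k₁ (ℕ.m≤m+n k₁ y)))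

memᵇ-++-high : ∀ {k₁} j θ₁ θ₂ → All (_< k₁) θ₁ → X.memᵇ (k₁ + j) (θ₁ ++ map (k₁ +_) θ₂) ≡ X.memᵇ j θ₂
memᵇ-++-high {k₁} j θ₁ θ₂ θ₁<k₁ =
  Reflects-⇔ (ℕ-Alphabet.memᵇ-reflects (k₁ + j) _) (ℕ-Alphabet.memᵇ-reflects j θ₂)
    (mk⇔ to (∈-++⁺ʳ θ₁ ∘ ∈-map⁺ (k₁ +_)))
  where
  to : k₁ + j ∈ θ₁ ++ map (k₁ +_) θ₂ → j ∈ θ₂
  to j∈ with ∈-++⁻ θ₁ j∈
  ... | inj₁ k₁+j∈θ₁ = ⊥-elim (ℕ.<-irrefl refl (ℕ.≤-<-trans (ℕ.m≤m+n k₁ j) (All.lookup θ₁<k₁ k₁+j∈θ₁)))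
  ... | inj₂ k₁+j∈ with y , y∈ , eq ← ∈-map⁻ (k₁ +_) k₁+j∈ = subst (_∈ θ₂) (sym (ℕ.+-cancelˡ-≡ k₁ j y eq)) y∈

AgreeBelow-++ : ∀ {k₁ k₂} θ₁ θ₂ θ → All (_< k₁) θ₁ →
  AgreeBelow (k₁ + k₂) (θ₁ ++ map (k₁ +_) θ₂) θ
    ⇔ (AgreeBelow k₁ θ₁ (window 0 k₁ θ) × AgreeBelow k₂ θ₂ (window k₁ k₂ θ))
AgreeBelow-++ {k₁} {k₂} θ₁ θ₂ θ θ₁<k₁ = mk⇔
  (λ agree → (λ j j<k₁ → trans (sym (memᵇ-++-low θ₁ θ₂ j<k₁))
                           (trans (agree j (ℕ.<-≤-trans j<k₁ (ℕ.m≤m+n k₁ k₂))) (memᵇ-window 0 k₁ j θ j<k₁)))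
           , (λ j j<k₂ → trans (sym (memᵇ-++-high j θ₁ θ₂ θ₁<k₁))
                           (trans (agree (k₁ + j) (ℕ.+-monoʳ-< k₁ j<k₂)) (memᵇ-window k₁ k₂ j θ j<k₂))))
  λ (agree₁ , agree₂) j j<k → joined agree₁ agree₂ j j<k (j ℕ.<? k₁)
  where
  joined : AgreeBelow k₁ θ₁ (window 0 k₁ θ) → AgreeBelow k₂ θ₂ (window k₁ k₂ θ) →
    ∀ j → j < k₁ + k₂ → Dec (j < k₁) → X.memᵇ j (θ₁ ++ map (k₁ +_) θ₂) ≡ X.memᵇ j θ
  joined agree₁ _ j _ (yes j<k₁) =
    trans (memᵇ-++-low θ₁ θ₂ j<k₁) (trans (agree₁ j j<k₁) (sym (memᵇ-window 0 k₁ j θ j<k₁)))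
  joined _ agree₂ j j<k (no j≮k₁) with j′ , refl ← ℕ.m≤n⇒∃[o]m+o≡n (ℕ.≮⇒≥ j≮k₁) =
    trans (memᵇ-++-high j′ θ₁ θ₂ θ₁<k₁) (trans (agree₂ j′ j′<k₂) (sym (memᵇ-window k₁ k₂ j′ θ j′<k₂)))
    where j′<k₂ = ℕ.+-cancelˡ-< k₁ j′ k₂ j<k

module _ {k₁ k₂ : ℕ} where
  open ShuffleCount (ℕ._<? k₁) ℕ._≟_ using (Split)

  split-window : ∀ c₁ c₂ c → All (_< k₁ + k₂) c →
    Split c₁ (map (k₁ +_) c₂) c ⇔ (c₁ ≡ window 0 k₁ c × c₂ ≡ window k₁ k₂ c)
  split-window c₁ c₂ c c<k = mk⇔
    (λ (e₁ , e₂) → trans e₁ (sym low) , trans (sym (map-∸-+ k₁ c₂)) (cong (map (_∸ k₁)) (trans e₂ (sym high))))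
    λ (e₁ , e₂) → trans e₁ low , trans (cong (map (k₁ +_)) e₂) (trans (map-+-∸ k₁ above) high)
    where
    low : window 0 k₁ c ≡ filter (ℕ._<? k₁) c
    low = trans (map-id _) (filter-≐ (inRange? 0 k₁) (ℕ._<? k₁) (proj₂ , (z≤n ,_)) c)
    high : filter (inRange? k₁ k₂) c ≡ filter (∁? (ℕ._<? k₁)) c
    high = filter-≐-All (inRange? k₁ k₂) (∁? (ℕ._<? k₁))
      (All.map (λ x<k → mk⇔ (λ (k₁≤x , _) x<k₁ → ℕ.<-irrefl refl (ℕ.<-≤-trans x<k₁ k₁≤x))
                            (λ x≮k₁ → ℕ.≮⇒≥ x≮k₁ , x<k)) c<k)
    above : All (k₁ ≤_) (filter (inRange? k₁ k₂) c)
    above = All.tabulate λ x∈ → proj₁ (proj₂ (∈-filter⁻ (inRange? k₁ k₂) {xs = c} x∈))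

_≟ₛ_ : DecidableEquality SetSeq
_≟ₛ_ = ≡-dec (≡-dec ℕ._≟_)

module _ {k₁ k₂ : ℕ} {θ₁ c₁ θ₂ c₂ : List ℕ}
  (θ₁<k₁ : All (_< k₁) θ₁) (c₁<k₁ : All (_< k₁) c₁) (c₂<k₂ : All (_< k₂) c₂) where

  open ShuffleCount (ℕ._<? k₁) ℕ._≟_ using (Split; split?; count-shuffles)

  private
    k : ℕ
    k = k₁ + k₂
    Θ : List ℕ
    Θ = θ₁ ++ map (k₁ +_) θ₂
    S : List (List ℕ)
    S = shuffles c₁ (map (k₁ +_) c₂)

    A? : ∀ J i → Dec (blocksOf k₁ (θ₁ , c₁) ≡ std (take i J))
    A? J i = blocksOf k₁ (θ₁ , c₁) ≟ₛ std (take i J)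

    B? : ∀ J i → Dec (blocksOf k₂ (θ₂ , c₂) ≡ std (drop i J))
    B? J i = blocksOf k₂ (θ₂ , c₂) ≟ₛ std (drop i J)

  splitting-term : SetSeq → ℕ → ℚ
  splitting-term J i = 𝟙 (A? J i) *ℚ 𝟙 (B? J i)

  shuffle-bound : ∀ {c} → c ∈ S → All (_< k) c
  shuffle-bound c∈ = All-resp-↭ (↭-sym (shuffles-↭ c₁ (map (k₁ +_) c₂) c∈))
    (All-++⁺ (All.map (λ x<k₁ → ℕ.<-≤-trans x<k₁ (ℕ.m≤m+n k₁ k₂)) c₁<k₁)
             (All-map⁺ (All.map (ℕ.+-monoʳ-< k₁) c₂<k₂)))

  splitting-lengths : ∀ {K i} u → i ≤ K → blocksOf k₁ (θ₁ , c₁) ≡ std (take i (blocksOf K u)) →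
    blocksOf k₂ (θ₂ , c₂) ≡ std (drop i (blocksOf K u)) → k₁ ≡ i × k₂ ≡ K ∸ i
  splitting-lengths {K} {i} u i≤K eA eB =
    trans (sym (length-blocksOf k₁ (θ₁ , c₁))) (trans (cong length eA) (length-std-take u i≤K)) ,
    trans (sym (length-blocksOf k₂ (θ₂ , c₂))) (trans (cong length eB) (length-std-drop i K u))

  private
    module _ (θ c : List ℕ) (c<k : All (_< k) c) where
      J : SetSeq
      J = blocksOf k (θ , c)

      E? : Dec (blocksOf k (Θ , c) ≡ J)
      E? = blocksOf k (Θ , c) ≟ₛ J

      matching-⇔ : ∀ {c'} → c' ∈ S → blocksOf k (Θ , c') ≡ J ⇔ (blocksOf k (Θ , c) ≡ J × c' ≡ c)
      matching-⇔ c'∈ = mk⇔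
        (λ eq → let (agree , c'≡c) = blocksOf-injective {Θ = Θ} {Θ' = θ} (shuffle-bound c'∈) c<k eq
                in blocksOf-cong Θ θ c agree , c'≡c)
        λ { (eq , refl) → eq }

      E-⇔ : blocksOf k (Θ , c) ≡ J ⇔ AgreeBelow k Θ θ
      E-⇔ = mk⇔ (proj₁ ∘ Equivalence.to (blocksOf-≡-⇔ {Θ = Θ} {Θ' = θ} c<k c<k)) (blocksOf-cong Θ θ c)

      A-⇔ : blocksOf k₁ (θ₁ , c₁) ≡ std (take k₁ J) ⇔ (AgreeBelow k₁ θ₁ (window 0 k₁ θ) × c₁ ≡ window 0 k₁ c)
      A-⇔ = subst (λ J₁ → (blocksOf k₁ (θ₁ , c₁) ≡ J₁) ⇔ (AgreeBelow k₁ θ₁ (window 0 k₁ θ) × c₁ ≡ window 0 k₁ c))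
        (sym (std-take-blocksOf θ c (ℕ.m≤m+n k₁ k₂)))
        (blocksOf-≡-⇔ {Θ = θ₁} {Θ' = window 0 k₁ θ} c₁<k₁ (window-bound 0 k₁ c))

      B-⇔ : blocksOf k₂ (θ₂ , c₂) ≡ std (drop k₁ J) ⇔ (AgreeBelow k₂ θ₂ (window k₁ k₂ θ) × c₂ ≡ window k₁ k₂ c)
      B-⇔ = subst (λ J₂ → (blocksOf k₂ (θ₂ , c₂) ≡ J₂) ⇔ (AgreeBelow k₂ θ₂ (window k₁ k₂ θ) × c₂ ≡ window k₁ k₂ c))
        (sym (std-drop-blocksOf k₁ k₂ θ c))
        (blocksOf-≡-⇔ {Θ = θ₂} {Θ' = window k₁ k₂ θ} c₂<k₂ (window-bound k₁ k₂ c))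

      -- Both conditions say: θ and c restrict to (θ₁, c₁) below k₁ and to (θ₂, c₂) above it.
      splitting-⇔ : (blocksOf k (Θ , c) ≡ J × Split c₁ (map (k₁ +_) c₂) c)
                  ⇔ (blocksOf k₁ (θ₁ , c₁) ≡ std (take k₁ J) × blocksOf k₂ (θ₂ , c₂) ≡ std (drop k₁ J))
      splitting-⇔ = mk⇔
        (λ (eq , split) →
          let (agree₁ , agree₂) = Equivalence.to (AgreeBelow-++ θ₁ θ₂ θ θ₁<k₁) (Equivalence.to E-⇔ eq)
              (c₁≡ , c₂≡) = Equivalence.to (split-window c₁ c₂ c c<k) split
          in Equivalence.from A-⇔ (agree₁ , c₁≡) , Equivalence.from B-⇔ (agree₂ , c₂≡))
        λ (eqA , eqB) →
          let (agree₁ , c₁≡) = Equivalence.to A-⇔ eqA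
              (agree₂ , c₂≡) = Equivalence.to B-⇔ eqB
          in Equivalence.from E-⇔ (Equivalence.from (AgreeBelow-++ θ₁ θ₂ θ θ₁<k₁) (agree₁ , agree₂))
           , Equivalence.from (split-window c₁ c₂ c c<k) (c₁≡ , c₂≡)

  coproduct-coefficient : ∀ K θ c → All (_< K) c →
    sumℚ (map (λ c' → 𝟙 (blocksOf k (Θ , c') ≟ₛ blocksOf K (θ , c))) S)
      ≡ sumℚ (map (splitting-term (blocksOf K (θ , c))) (upTo (suc K)))
  -- Unless k = K, both sides vanish by counting blocks.
  coproduct-coefficient K θ c c<K with k ℕ.≟ K
  ... | no k≢K = trans (sumℚ-map-zero S λ {c'} _ → 𝟙-no _ (k≢K ∘ blocksOf-length {u = Θ , c'} {u' = θ , c}))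
    (sym (sumℚ-map-zero (upTo (suc K)) λ {i} i∈ →
      let i≤K = ℕ.≤-pred (∈-upTo⁻ i∈) in
      trans (sym (𝟙-× (A? _ i) (B? _ i))) (𝟙-no _ λ (eqA , eqB) →
        let (k₁≡i , k₂≡K∸i) = splitting-lengths (θ , c) i≤K eqA eqB
        in k≢K (trans (cong₂ _+_ k₁≡i k₂≡K∸i) (ℕ.m+[n∸m]≡n i≤K)))))
  ... | yes refl = begin
    sumℚ (map (λ c' → 𝟙 (blocksOf k (Θ , c') ≟ₛ J θ c c<K)) S)
      ≡⟨ sumℚ-map-cong S (λ {c'} c'∈ → trans (𝟙-cong _ (E? θ c c<K ×-dec c' ≟ₗ c) (matching-⇔ θ c c<K c'∈))
                                               (𝟙-× (E? θ c c<K) (c' ≟ₗ c))) ⟩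
    sumℚ (map (λ c' → 𝟙 (E? θ c c<K) *ℚ 𝟙 (c' ≟ₗ c)) S)
      ≡⟨ sumℚ-map-*ˡ (𝟙 (E? θ c c<K)) (λ c' → 𝟙 (c' ≟ₗ c)) S ⟩
    𝟙 (E? θ c c<K) *ℚ sumℚ (map (λ c' → 𝟙 (c' ≟ₗ c)) S)
      ≡⟨ cong (𝟙 (E? θ c c<K) *ℚ_)
              (count-shuffles c₁ (map (k₁ +_) c₂) c c₁<k₁ (All-map⁺ (All.universal not-below _))) ⟩
    𝟙 (E? θ c c<K) *ℚ 𝟙 (split? c₁ (map (k₁ +_) c₂) c)
      ≡⟨ sym (𝟙-× (E? θ c c<K) (split? c₁ (map (k₁ +_) c₂) c)) ⟩
    𝟙 (E? θ c c<K ×-dec split? c₁ (map (k₁ +_) c₂) c)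
      ≡⟨ 𝟙-cong _ (A? (J θ c c<K) k₁ ×-dec B? (J θ c c<K) k₁) (splitting-⇔ θ c c<K) ⟩
    𝟙 (A? (J θ c c<K) k₁ ×-dec B? (J θ c c<K) k₁)
      ≡⟨ 𝟙-× (A? (J θ c c<K) k₁) (B? (J θ c c<K) k₁) ⟩
    splitting-term (J θ c c<K) k₁
      ≡⟨ sym (sumℚ-upTo-single (splitting-term (J θ c c<K)) (suc k) (s≤s (ℕ.m≤m+n k₁ k₂)) only-k₁) ⟩
    sumℚ (map (splitting-term (J θ c c<K)) (upTo (suc k))) ∎
    where
    open ≡-Reasoning
    _≟ₗ_ = ≡-dec ℕ._≟_
    not-below : ∀ y → ¬ (k₁ + y < k₁)
    not-below y k₁+y<k₁ = ℕ.<-irrefl refl (ℕ.<-≤-trans k₁+y<k₁ (ℕ.m≤m+n k₁ y))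
    only-k₁ : ∀ i → i < suc k → i ≢ k₁ → splitting-term (J θ c c<K) i ≡ 0ℚ
    only-k₁ i i<1+k i≢k₁ = trans (sym (𝟙-× (A? _ i) (B? _ i))) (𝟙-no _ λ (eqA , eqB) →
      i≢k₁ (sym (proj₁ (splitting-lengths (θ , c) (ℕ.≤-pred i<1+k) eqA eqB))))

  coproduct-coefficient-supercomposition : ∀ {n I} → IsSetSupercomposition n I →
    sumℚ (map (λ c' → 𝟙 (blocksOf k (Θ , c') ≟ₛ I)) S) ≡ sumℚ (map (splitting-term I) (upTo (suc (length I))))
  coproduct-coefficient-supercomposition {n} {I} sc =
    subst (λ J → sumℚ (map (λ c' → 𝟙 (blocksOf k (Θ , c') ≟ₛ J)) S)
               ≡ sumℚ (map (splitting-term J) (upTo (suc (length I)))))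
      (blocksOf-standardMonomial sc)
      (coproduct-coefficient (length I) (fermionicBlocks I) (letters (blockIndex I) 1 n) (blockWord-bound sc))

-- Two alphabets

increasing? : (t : List ℕ) → Dec (Linked _<_ t)
increasing? = linked? (StrictTotalOrder._<?_ ℕ.<-strictTotalOrder)

⊎-order : StrictTotalOrder 0ℓ 0ℓ 0ℓ
⊎-order = LeftOrder.⊎-<-strictTotalOrder {a = 0ℓ} {b = 0ℓ} {c = 0ℓ} {d = 0ℓ} {e = 0ℓ} {f = 0ℓ}
  ℕ.<-strictTotalOrder ℕ.<-strictTotalOrder

open StrictTotalOrder ⊎-order using () renaming (_<_ to _<ₓᵧ_; _<?_ to _<ₓᵧ?_)
module XY-Alphabet = OrderedAlphabet ⊎-order Pointwise.Pointwise-≡⇒≡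
module XY-Standardization = Standardization ⊎-order Pointwise.Pointwise-≡⇒≡

Linked-⊎ : ∀ a b → Linked _<ₓᵧ_ (map inj₁ a ++ map inj₂ b) ⇔ (Linked _<_ a × Linked _<_ b)
Linked-⊎ a b = mk⇔
  (λ ab↗ → let (a↗ , b↗) = AllPairs-++⁻ (map inj₁ a) (Linked⇒AllPairs (StrictTotalOrder.trans ⊎-order) ab↗) in
    AllPairs⇒Linked (AllPairs.map LeftOrder.drop-inj₁ (AllPairs.map⁻ a↗)) ,
    AllPairs⇒Linked (AllPairs.map LeftOrder.drop-inj₂ (AllPairs.map⁻ b↗)))
  λ (a↗ , b↗) → AllPairs⇒Linked (AllPairs.++⁺
    (AllPairs.map⁺ (AllPairs.map LeftOrder.₁∼₁ (Linked⇒AllPairs ℕ.<-trans a↗)))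
    (AllPairs.map⁺ (AllPairs.map LeftOrder.₂∼₂ (Linked⇒AllPairs ℕ.<-trans b↗)))
    (All-map⁺ (All.universal (λ _ → All-map⁺ (All.universal (λ _ → LeftOrder.₁∼₂) b)) a)))

M-standardized : ∀ J t w → let K = X.indexSet (t , w); open ℕ-Standardization in
  X.M J (t , w) ≡ 𝟙 (increasing? t) *ℚ 𝟙 (blocksOf (length K) (map (rank K) t , map (rank K) w) ≟ₛ J)
M-standardized J t w = trans (𝟙-× (increasing? t) (X.I[ t , w ] ≟ₛ J))
  (cong (λ J′ → 𝟙 (increasing? t) *ℚ 𝟙 (J′ ≟ₛ J)) (ℕ-Standardization.I-standardized t w))

module TwoAlphabets (t w t' w' : List ℕ) where

  open ℕ-Standardization using (rank)
  open XY-Standardization using () renaming (rank to rankₓᵧ)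

  K L : List ℕ
  K = X.indexSet (t , w)
  L = X.indexSet (t' , w')

  KL T : List (ℕ ⊎ ℕ)
  KL = map inj₁ K ++ map inj₂ L
  T = map inj₁ t ++ map inj₂ t'

  shuffled : List (List (ℕ ⊎ ℕ))
  shuffled = shuffles (map inj₁ w) (map inj₂ w')

  indexSet-shuffle : ∀ {z} → z ∈ shuffled → XY.indexSet (T , z) ≡ KL
  indexSet-shuffle {z} z∈ = XY-Alphabet.sorted-≡ (XY-Alphabet.indexSet-sorted (T , z)) KL↗ same-elements
    where
    open PermutationReasoning
    regroup : T ++ z ↭ map inj₁ (t ++ w) ++ map inj₂ (t' ++ w')
    regroup = begin
      (map inj₁ t ++ map inj₂ t') ++ z
        ↭⟨ ++⁺ˡ T (shuffles-↭ (map inj₁ w) (map inj₂ w') z∈) ⟩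
      (map inj₁ t ++ map inj₂ t') ++ (map inj₁ w ++ map inj₂ w')
        ≡⟨ List.++-assoc (map inj₁ t) _ _ ⟩
      map inj₁ t ++ (map inj₂ t' ++ (map inj₁ w ++ map inj₂ w'))
        ↭⟨ ++⁺ˡ (map inj₁ t) (shifts (map inj₂ t') (map inj₁ w)) ⟩
      map inj₁ t ++ (map inj₁ w ++ (map inj₂ t' ++ map inj₂ w'))
        ≡⟨ sym (List.++-assoc (map inj₁ t) _ _) ⟩
      (map inj₁ t ++ map inj₁ w) ++ (map inj₂ t' ++ map inj₂ w')
        ≡⟨ sym (cong₂ _++_ (map-++ inj₁ t w) (map-++ inj₂ t' w')) ⟩
      map inj₁ (t ++ w) ++ map inj₂ (t' ++ w') ∎
    same-elements : ∀ {y} → y ∈ XY.indexSet (T , z) ⇔ y ∈ KL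
    same-elements = ⇔.trans (XY-Alphabet.∈-indexSet T z) (⇔.trans (bag-=⇒ (↭⇒∼bag regroup))
      (++-cong (SetEq.map-cong (λ _ → refl) (⇔.sym (ℕ-Alphabet.∈-indexSet t w)))
               (SetEq.map-cong (λ _ → refl) (⇔.sym (ℕ-Alphabet.∈-indexSet t' w')))))
    KL↗ : AllPairs _<ₓᵧ_ KL
    KL↗ = AllPairs.++⁺
      (AllPairs.map⁺ (AllPairs.map LeftOrder.₁∼₁ (ℕ-Alphabet.indexSet-sorted (t , w))))
      (AllPairs.map⁺ (AllPairs.map LeftOrder.₂∼₂ (ℕ-Alphabet.indexSet-sorted (t' , w'))))
      (All-map⁺ (All.universal (λ _ → All-map⁺ (All.universal (λ _ → LeftOrder.₁∼₂) L)) K))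

  rank-inj₁ : ∀ a → rankₓᵧ KL (inj₁ a) ≡ rank K a
  rank-inj₁ a = begin
    count (_<ₓᵧ? inj₁ a) (map inj₁ K ++ map inj₂ L)
      ≡⟨ count-++ (_<ₓᵧ? inj₁ a) (map inj₁ K) (map inj₂ L) ⟩
    count (_<ₓᵧ? inj₁ a) (map inj₁ K) + count (_<ₓᵧ? inj₁ a) (map inj₂ L)
      ≡⟨ cong₂ _+_ (count-map (_<ₓᵧ? inj₁ a) inj₁ K) (count-map (_<ₓᵧ? inj₁ a) inj₂ L) ⟩
    count ((_<ₓᵧ? inj₁ a) ∘ inj₁) K + count ((_<ₓᵧ? inj₁ a) ∘ inj₂) L
      ≡⟨ cong₂ _+_ (cong length (filter-≐ _ _ (LeftOrder.drop-inj₁ , LeftOrder.₁∼₁) K))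
                   (cong length (filter-none ((_<ₓᵧ? inj₁ a) ∘ inj₂) (All.universal (λ _ ()) L))) ⟩
    rank K a + 0
      ≡⟨ ℕ.+-identityʳ (rank K a) ⟩
    rank K a ∎
    where open ≡-Reasoning

  rank-inj₂ : ∀ b → rankₓᵧ KL (inj₂ b) ≡ length K + rank L b
  rank-inj₂ b = begin
    count (_<ₓᵧ? inj₂ b) (map inj₁ K ++ map inj₂ L)
      ≡⟨ count-++ (_<ₓᵧ? inj₂ b) (map inj₁ K) (map inj₂ L) ⟩
    count (_<ₓᵧ? inj₂ b) (map inj₁ K) + count (_<ₓᵧ? inj₂ b) (map inj₂ L)
      ≡⟨ cong₂ _+_ (count-map (_<ₓᵧ? inj₂ b) inj₁ K) (count-map (_<ₓᵧ? inj₂ b) inj₂ L) ⟩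
    count ((_<ₓᵧ? inj₂ b) ∘ inj₁) K + count ((_<ₓᵧ? inj₂ b) ∘ inj₂) L
      ≡⟨ cong₂ _+_ (cong length (filter-all ((_<ₓᵧ? inj₂ b) ∘ inj₁) (All.universal (λ _ → LeftOrder.₁∼₂) K)))
                   (cong length (filter-≐ _ _ (LeftOrder.drop-inj₂ , LeftOrder.₂∼₂) L)) ⟩
    length K + rank L b ∎
    where open ≡-Reasoning

  k₁ k₂ : ℕ
  k₁ = length K
  k₂ = length L

  ρ : ℕ ⊎ ℕ → ℕ
  ρ = rankₓᵧ KL

  map-inj₁ : ∀ xs → map ρ (map inj₁ xs) ≡ map (rank K) xs
  map-inj₁ xs = trans (sym (map-∘ xs)) (map-cong rank-inj₁ xs)

  map-inj₂ : ∀ xs → map ρ (map inj₂ xs) ≡ map (k₁ +_) (map (rank L) xs)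
  map-inj₂ xs = trans (sym (map-∘ xs)) (trans (map-cong rank-inj₂ xs) (map-∘ xs))

  standardized-θ : map ρ T ≡ map (rank K) t ++ map (k₁ +_) (map (rank L) t')
  standardized-θ = begin
    map ρ (map inj₁ t ++ map inj₂ t')          ≡⟨ map-++ ρ (map inj₁ t) (map inj₂ t') ⟩
    map ρ (map inj₁ t) ++ map ρ (map inj₂ t')  ≡⟨ cong₂ _++_ (map-inj₁ t) (map-inj₂ t') ⟩
    map (rank K) t ++ map (k₁ +_) (map (rank L) t') ∎
    where open ≡-Reasoning

  standardized-shuffles : map (map ρ) shuffled ≡ shuffles (map (rank K) w) (map (k₁ +_) (map (rank L) w'))
  standardized-shuffles =
    trans (map-shuffles ρ (map inj₁ w) (map inj₂ w')) (cong₂ shuffles (map-inj₁ w) (map-inj₂ w'))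

  I-shuffle : ∀ {z} → z ∈ shuffled →
    XY.I[ T , z ] ≡ blocksOf (k₁ + k₂) (map (rank K) t ++ map (k₁ +_) (map (rank L) t') , map ρ z)
  I-shuffle {z} z∈ = begin
    XY.I[ T , z ]
      ≡⟨ XY-Standardization.I-standardized T z ⟩
    blocksOf (length Kz) (map (rankₓᵧ Kz) T , map (rankₓᵧ Kz) z)
      ≡⟨ cong (λ K′ → blocksOf (length K′) (map (rankₓᵧ K′) T , map (rankₓᵧ K′) z)) (indexSet-shuffle z∈) ⟩
    blocksOf (length KL) (map ρ T , map ρ z)
      ≡⟨ cong₂ (λ k θ → blocksOf k (θ , map ρ z)) length-KL standardized-θ ⟩
    blocksOf (k₁ + k₂) (map (rank K) t ++ map (k₁ +_) (map (rank L) t') , map ρ z) ∎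
    where
    open ≡-Reasoning
    Kz : List (ℕ ⊎ ℕ)
    Kz = XY.indexSet (T , z)
    length-KL : length KL ≡ k₁ + k₂
    length-KL = trans (length-++ (map inj₁ K)) (cong₂ _+_ (length-map inj₁ K) (length-map inj₂ L))

  ΔM-standardized : ∀ I → ΔM I ((t , w) , (t' , w'))
    ≡ (𝟙 (increasing? t) *ℚ 𝟙 (increasing? t')) *ℚ
      sumℚ (map (λ c → 𝟙 (blocksOf (k₁ + k₂) (map (rank K) t ++ map (k₁ +_) (map (rank L) t') , c) ≟ₛ I))
                (shuffles (map (rank K) w) (map (k₁ +_) (map (rank L) w'))))
  ΔM-standardized I = begin
    sumℚ (map (λ z → 𝟙 (increasingₓᵧ? T ×-dec XY.I[ T , z ] ≟ₛ I)) shuffled)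
      ≡⟨ sumℚ-map-cong shuffled (λ {z} z∈ → trans (𝟙-× (increasingₓᵧ? T) (XY.I[ T , z ] ≟ₛ I))
                                                 (cong (λ J → 𝟙 (increasingₓᵧ? T) *ℚ 𝟙 (J ≟ₛ I)) (I-shuffle z∈))) ⟩
    sumℚ (map (λ z → 𝟙 (increasingₓᵧ? T) *ℚ g (map ρ z)) shuffled)
      ≡⟨ sumℚ-map-*ˡ (𝟙 (increasingₓᵧ? T)) (g ∘ map ρ) shuffled ⟩
    𝟙 (increasingₓᵧ? T) *ℚ sumℚ (map (g ∘ map ρ) shuffled)
      ≡⟨ cong₂ _*ℚ_ (trans (𝟙-cong (increasingₓᵧ? T) (increasing? t ×-dec increasing? t') (Linked-⊎ t t'))
                           (𝟙-× (increasing? t) (increasing? t')))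
                    (cong sumℚ (trans (map-∘ shuffled) (cong (map g) standardized-shuffles))) ⟩
    (𝟙 (increasing? t) *ℚ 𝟙 (increasing? t')) *ℚ
      sumℚ (map g (shuffles (map (rank K) w) (map (k₁ +_) (map (rank L) w')))) ∎
    where
    open ≡-Reasoning
    increasingₓᵧ? : (T : List (ℕ ⊎ ℕ)) → Dec (Linked _<ₓᵧ_ T)
    increasingₓᵧ? = linked? _<ₓᵧ?_
    g : List ℕ → ℚ
    g c = 𝟙 (blocksOf (k₁ + k₂) (map (rank K) t ++ map (k₁ +_) (map (rank L) t') , c) ≟ₛ I)

proposition4p4 : (n : ℕ) (I : SetSeq) → IsSetSupercomposition n I →
    (u v : X.Mono) →
    ΔM I (u , v)
      ≡ sumℚ (map (λ i → (X.M (std (take i I)) ⊗ X.M (std (drop i I))) (u , v))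
                  (upTo (suc (length I))))
proposition4p4 n I sc (t , w) (t' , w') = begin
  ΔM I ((t , w) , (t' , w'))
    ≡⟨ ΔM-standardized I ⟩
  𝟙tt' *ℚ sumℚ (map (λ c → 𝟙 (blocksOf (k₁ + k₂) (θ₁ ++ map (k₁ +_) θ₂ , c) ≟ₛ I)) (shuffles c₁ (map (k₁ +_) c₂)))
    ≡⟨ cong (𝟙tt' *ℚ_) (coproduct-coefficient-supercomposition {θ₂ = θ₂} θ₁<k₁ c₁<k₁ c₂<k₂ sc) ⟩
  𝟙tt' *ℚ sumℚ (map term (upTo (suc (length I))))
    ≡⟨ sym (sumℚ-map-*ˡ 𝟙tt' term (upTo (suc (length I)))) ⟩
  sumℚ (map (λ i → 𝟙tt' *ℚ term i) (upTo (suc (length I))))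
    ≡⟨ sumℚ-map-cong (upTo (suc (length I))) (λ {i} _ →
         trans (interchange (𝟙 (increasing? t)) (𝟙 (increasing? t')) _ _)
               (sym (cong₂ _*ℚ_ (M-standardized (std (take i I)) t w) (M-standardized (std (drop i I)) t' w')))) ⟩
  sumℚ (map (λ i → (X.M (std (take i I)) ⊗ X.M (std (drop i I))) ((t , w) , (t' , w'))) (upTo (suc (length I)))) ∎
  where
  open ≡-Reasoning
  open TwoAlphabets t w t' w'
  open ℕ-Standardization using (rank; rank-bound-map)
  𝟙tt' : ℚ
  𝟙tt' = 𝟙 (increasing? t) *ℚ 𝟙 (increasing? t')
  θ₁ c₁ θ₂ c₂ : List ℕ
  θ₁ = map (rank K) t
  c₁ = map (rank K) w
  θ₂ = map (rank L) t'
  c₂ = map (rank L) w'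
  θ₁<k₁ : All (_< k₁) θ₁
  θ₁<k₁ = rank-bound-map K t (Equivalence.from (ℕ-Alphabet.∈-indexSet t w) ∘ ∈-++⁺ˡ)
  c₁<k₁ : All (_< k₁) c₁
  c₁<k₁ = rank-bound-map K w (Equivalence.from (ℕ-Alphabet.∈-indexSet t w) ∘ ∈-++⁺ʳ t)
  c₂<k₂ : All (_< k₂) c₂
  c₂<k₂ = rank-bound-map L w' (Equivalence.from (ℕ-Alphabet.∈-indexSet t' w') ∘ ∈-++⁺ʳ t')
  term : ℕ → ℚ
  term = splitting-term {θ₂ = θ₂} θ₁<k₁ c₁<k₁ c₂<k₂ I
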